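{- Let $t\ge3$, $n\ge1$, and let $\lambda$ be a partition with $\ell(\lambda)\le tn$. Write $n_i=n_i(\lambda,tn)$. Then the $t$-core of $\lambda$ is a symplectic $t$-core if and only if $n_i+n_{t-2-i}=2n$ for all $0\le i\le\lfloor (t-2)/2\rfloor$ and $n_{t-1}=n$.
   Context: For a partition $\lambda$ with $\ell(\lambda)\le m$, $\beta(\lambda,m)=(\lambda_j+m-j)_{j=1}^m$ and $n_i(\lambda,m)$ is the number of its entries congruent to $i$ mod $t$. The $t$-core of $\lambda$ is obtained by successively removing border strips of size $t$ until none can be removed. A partition is symplectic if in Frobenius coordinates it is $(\alpha|\alpha+1)$, i.e. with rank $r$ (largest $r$ with $\lambda_r\ge r$), $\lambda'_i-i=\lambda_i-i+1$ for $1\le i\le r$ (empty partition included); a symplectic $t$-core is a symplectic partition that is a $t$-core. -}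

module Defs where

open import Data.Nat using (ℕ; zero; suc; _+_; _*_; _∸_; _≤_; _<_; _≥_; _≤?_; _≟_; NonZero)
open import Data.Nat.DivMod using (_%_)
open import Data.List using (List; []; _∷_; length; map; filter; upTo)
open import Data.Nat.ListAction using (sum)
open import Data.List.Relation.Unary.All using (All)
open import Data.List.Relation.Unary.Linked using (Linked)
open import Data.Product using (_×_; Σ; _,_; ∃)
open import Data.Sum using (_⊎_)
open import Relation.Nullary using (¬_)
open import Relation.Binary.PropositionalEquality using (_≡_)
open import Relation.Binary.Construct.Closure.ReflexiveTransitive using (Star)

record Partition : Set where
  field
    parts : List ℕ
    decr  : Linked _≥_ parts
    pos   : All (λ x → 0 < x) parts
open Partition public

len : Partition → ℕ
len p = length (parts p)

nth : List ℕ → ℕ → ℕ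
nth []       _       = 0
nth (x ∷ xs) zero    = x
nth (x ∷ xs) (suc i) = nth xs i

-- 0-indexed row length λ_{i+1}
row : Partition → ℕ → ℕ
row p i = nth (parts p) i

-- 1-indexed λ_i (λ_0 := 0, never used)
part : Partition → ℕ → ℕ
part p zero    = 0
part p (suc i) = row p i

conj : Partition → ℕ → ℕ
conj p i = length (filter (λ x → i ≤? x) (parts p))

beta : Partition → ℕ → List ℕ
beta p m = map (λ j → row p j + (m ∸ suc j)) (upTo m)

nCount : (t : ℕ) → {{NonZero t}} → Partition → ℕ → ℕ → ℕ
nCount t p m i = length (filter (λ b → (b % t) ≟ i) (beta p m))

-- Young diagrams, skew shapes and border strips (0-indexed cells (row, col))

Cell : Set
Cell = ℕ × ℕ

_⊆ₚ_ : Partition → Partition → Set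
μ ⊆ₚ la = ∀ i → row μ i ≤ row la i

InSkew : Partition → Partition → Cell → Set
InSkew la μ (i , j) = (j < row la i) × (row μ i ≤ j)

skewSize : Partition → Partition → ℕ
skewSize la μ = sum (map (λ i → row la i ∸ row μ i) (upTo (len la)))

Adj : Cell → Cell → Set
Adj (i , j) (i' , j') =
  (i ≡ i' × (suc j ≡ j' ⊎ suc j' ≡ j)) ⊎ (j ≡ j' × (suc i ≡ i' ⊎ suc i' ≡ i))

SkewStep : Partition → Partition → Cell → Cell → Set
SkewStep la μ c d = Adj c d × InSkew la μ c × InSkew la μ d

Connected : Partition → Partition → Set
Connected la μ = ∀ c d → InSkew la μ c → InSkew la μ d → Star (SkewStep la μ) c d

No2x2 : Partition → Partition → Set
No2x2 la μ = ∀ i j →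
  ¬ (InSkew la μ (i , j) × InSkew la μ (suc i , j) ×
     InSkew la μ (i , suc j) × InSkew la μ (suc i , suc j))

RemoveStrip : ℕ → Partition → Partition → Set
RemoveStrip t la μ =
  (μ ⊆ₚ la) × Connected la μ × No2x2 la μ × (skewSize la μ ≡ t)

IsTCore : ℕ → Partition → Set
IsTCore t la = ¬ (Σ Partition λ μ → RemoveStrip t la μ)

IsTCoreOf : ℕ → Partition → Partition → Set
IsTCoreOf t la μ = Star (RemoveStrip t) la μ × IsTCore t μ

IsRank : Partition → ℕ → Set
IsRank la r = (r ≡ 0 ⊎ r ≤ part la r) × (∀ s → 1 ≤ s → s ≤ part la s → s ≤ r)

-- Frobenius form (α | α+1): λ'_i - i = λ_i - i + 1 for 1 ≤ i ≤ r,
-- written over ℕ as λ'_i = λ_i + 1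
Symplectic : Partition → Set
Symplectic la = ∀ r → IsRank la r → ∀ i → 1 ≤ i → i ≤ r → conj la i ≡ part la i + 1

SymplecticTCore : ℕ → Partition → Set
SymplecticTCore t la = Symplectic la × IsTCore t la

{-# OPTIONS --safe #-}
-- Removing a rim hook of size t lowers one entry of β(λ, m) by t, so λ and its
-- t-core μ have the same counts n_i, and on the t-abacus of μ each runner ρ
-- holds exactly its n_ρ lowest positions.  The Frobenius condition (α | α + 1)
-- says that position m − 1 carries a bead and that, for y ≥ m, exactly one of
-- y and 2m − 2 − y does.  The reflection y ↦ 2m − 2 − y pairs runner ρ with
-- runner t − 2 − ρ and maps runner t − 1 to itself, which turns this into
-- n_ρ + n_{t−2−ρ} = 2n and n_{t−1} = n.
module Submission where

open import Defs
open import Data.Nat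
open import Data.Nat.Properties
open import Data.Nat.DivMod using (_%_; _/_; [m+n]%n≡m%n; [m+kn]%n≡m%n; m<n⇒m%n≡m; m≡m%n+[m/n]*n; m/n≤m; m%n<n)
open import Data.Nat.ListAction using (sum)
open import Data.Nat.Solver using (module +-*-Solver)
open +-*-Solver using (solve; _:+_; _:*_; _:=_; con)
open import Data.List using ([]; _∷_; length; filter; applyUpTo)
open import Data.List.Properties using (map-upTo; length-applyUpTo)
open import Data.List.Relation.Unary.All using (All; []; _∷_)
import Data.List.Relation.Unary.All.Properties as Allₚ
open import Data.List.Relation.Unary.Linked using (Linked; _∷_)
import Data.List.Relation.Unary.Linked.Properties as Linkedₚ
open import Data.Product using (_×_; Σ; _,_; proj₁; proj₂)
open import Data.Sum using (_⊎_; inj₁; inj₂)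
open import Data.Empty using (⊥; ⊥-elim)
open import Function.Bundles using (_⇔_; mk⇔)
open import Relation.Nullary using (¬_; Dec; yes; no)
open import Relation.Binary using (tri<; tri≈; tri>)
open import Relation.Binary.PropositionalEquality
open import Relation.Binary.Construct.Closure.ReflexiveTransitive using (Star; ε; _◅_; _◅◅_; reverse)

∑< : (ℕ → ℕ) → ℕ → ℕ
∑< f zero    = 0
∑< f (suc k) = f 0 + ∑< (λ i → f (suc i)) k

indicator : {P : Set} → Dec P → ℕ
indicator (yes _) = 1
indicator (no _)  = 0

indicator-yes : {P : Set} (d : Dec P) → P → indicator d ≡ 1
indicator-yes (yes _) p = refl
indicator-yes (no ¬p) p = ⊥-elim (¬p p)

indicator-no : {P : Set} (d : Dec P) → ¬ P → indicator d ≡ 0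
indicator-no (yes p) ¬p = ⊥-elim (¬p p)
indicator-no (no _)  ¬p = refl

indicator-pos⇒ : {P : Set} (d : Dec P) → 0 < indicator d → P
indicator-pos⇒ (yes p) _ = p

indicator-cong : {P Q : Set} (d : Dec P) (e : Dec Q) → (P → Q) → (Q → P) → indicator d ≡ indicator e
indicator-cong (yes p) (yes q) f g = refl
indicator-cong (yes p) (no ¬q) f g = ⊥-elim (¬q (f p))
indicator-cong (no ¬p) (yes q) f g = ⊥-elim (¬p (g q))
indicator-cong (no ¬p) (no ¬q) f g = refl

indicator≤1 : {P : Set} (d : Dec P) → indicator d ≤ 1
indicator≤1 (yes _) = s≤s z≤n
indicator≤1 (no _)  = z≤n

indicator-1≤? : ∀ v → v ≤ 1 → indicator (1 ≤? v) ≡ v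
indicator-1≤? zero          _ = refl
indicator-1≤? (suc zero)    _ = refl
indicator-1≤? (suc (suc v)) (s≤s ())

∑<-cong : ∀ {f g} k → (∀ i → i < k → f i ≡ g i) → ∑< f k ≡ ∑< g k
∑<-cong zero    h = refl
∑<-cong (suc k) h = cong₂ _+_ (h 0 (s≤s z≤n)) (∑<-cong k (λ i i<k → h (suc i) (s≤s i<k)))

∑<-split : ∀ f a b → ∑< f (a + b) ≡ ∑< f a + ∑< (λ i → f (a + i)) b
∑<-split f zero    b = refl
∑<-split f (suc a) b = trans (cong (f 0 +_) (∑<-split (λ i → f (suc i)) a b)) (sym (+-assoc (f 0) _ _))

∑<-snoc : ∀ f k → ∑< f (suc k) ≡ ∑< f k + f k
∑<-snoc f zero    = +-comm (f 0) 0
∑<-snoc f (suc k) = trans (cong (f 0 +_) (∑<-snoc (λ i → f (suc i)) k)) (sym (+-assoc (f 0) _ _))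

∑<-1 : ∀ k → ∑< (λ _ → 1) k ≡ k
∑<-1 zero    = refl
∑<-1 (suc k) = cong suc (∑<-1 k)

∑<-zero : ∀ {f} k → (∀ i → i < k → f i ≡ 0) → ∑< f k ≡ 0
∑<-zero zero    h = refl
∑<-zero (suc k) h = cong₂ _+_ (h 0 (s≤s z≤n)) (∑<-zero k (λ i i<k → h (suc i) (s≤s i<k)))

∑<-+ : ∀ f g k → ∑< (λ i → f i + g i) k ≡ ∑< f k + ∑< g k
∑<-+ f g zero    = refl
∑<-+ f g (suc k) rewrite ∑<-+ (λ i → f (suc i)) (λ i → g (suc i)) k =
  solve 4 (λ a b c d → (a :+ b) :+ (c :+ d) := (a :+ c) :+ (b :+ d)) refl
    (f 0) (g 0) (∑< (λ i → f (suc i)) k) (∑< (λ i → g (suc i)) k)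

∑<-swap : ∀ (F : ℕ → ℕ → ℕ) m M → ∑< (λ q → ∑< (F q) M) m ≡ ∑< (λ k → ∑< (λ q → F q k) m) M
∑<-swap F zero    M = sym (∑<-zero M (λ _ _ → refl))
∑<-swap F (suc m) M = trans (cong (∑< (F 0) M +_) (∑<-swap (λ q → F (suc q)) m M))
  (sym (∑<-+ (F 0) (λ k → ∑< (λ q → F (suc q) k) m) M))

∑<-mono : ∀ {f g} k → (∀ i → i < k → f i ≤ g i) → ∑< f k ≤ ∑< g k
∑<-mono zero    h = z≤n
∑<-mono (suc k) h = +-mono-≤ (h 0 (s≤s z≤n)) (∑<-mono k (λ i i<k → h (suc i) (s≤s i<k)))

term≤∑< : ∀ f k i → i < k → f i ≤ ∑< f k
term≤∑< f (suc k) zero    _        = m≤m+n (f 0) _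
term≤∑< f (suc k) (suc i) (s≤s lt) = ≤-trans (term≤∑< (λ j → f (suc j)) k i lt) (m≤n+m _ (f 0))

∑<-pos⇒term : ∀ f k → 0 < ∑< f k → Σ ℕ λ i → i < k × 0 < f i
∑<-pos⇒term f zero    ()
∑<-pos⇒term f (suc k) p with f 0 in eq
... | suc _ = 0 , s≤s z≤n , subst (0 <_) (sym eq) (s≤s z≤n)
... | zero with ∑<-pos⇒term (λ i → f (suc i)) k p
...   | i , i<k , q = suc i , s≤s i<k , q

∑<-rotate : ∀ g h k → (∀ j → j < k → g j ≡ h (suc j)) → g k ≡ h 0 → ∑< g (suc k) ≡ ∑< h (suc k)
∑<-rotate g h k shift wrap =
  trans (∑<-snoc g k) (trans (cong₂ _+_ (∑<-cong k shift) wrap) (+-comm _ (h 0)))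

∑<-split₃ : ∀ f a b c →
  ∑< f (a + (b + c)) ≡ ∑< f a + (∑< (λ i → f (a + i)) b + ∑< (λ i → f (a + (b + i))) c)
∑<-split₃ f a b c = trans (∑<-split f a (b + c)) (cong (∑< f a +_) (∑<-split (λ i → f (a + i)) b c))

∑<-window : ∀ f a b c → (∀ i → i < a → f i ≡ 0) → (∀ i → f (a + (b + i)) ≡ 0) →
  ∑< f (a + (b + c)) ≡ ∑< (λ i → f (a + i)) b
∑<-window f a b c below above = begin
    ∑< f (a + (b + c))
  ≡⟨ ∑<-split₃ f a b c ⟩
    ∑< f a + (X + ∑< (λ i → f (a + (b + i))) c)
  ≡⟨ cong₂ (λ u v → u + (X + v)) (∑<-zero a below) (∑<-zero c (λ i _ → above i)) ⟩
    X + 0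
  ≡⟨ +-identityʳ X ⟩
    X
  ∎
  where
  open ≡-Reasoning
  X = ∑< (λ i → f (a + i)) b

∑<-cong-window : ∀ f g a b c → (∀ i → i < a → f i ≡ g i) → (∀ i → f (a + (b + i)) ≡ g (a + (b + i))) →
  ∑< (λ i → f (a + i)) b ≡ ∑< (λ i → g (a + i)) b → ∑< f (a + (b + c)) ≡ ∑< g (a + (b + c))
∑<-cong-window f g a b c below above middle =
  trans (∑<-split₃ f a b c)
    (trans (cong₂ _+_ (∑<-cong a below) (cong₂ _+_ middle (∑<-cong c (λ i _ → above i))))
           (sym (∑<-split₃ g a b c)))

window : ∀ {a b L} → a ≤ b → b < L → a + (suc (b ∸ a) + (L ∸ suc b)) ≡ L
window {a} {b} {L} a≤b b<L = begin
    a + (suc (b ∸ a) + (L ∸ suc b))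
  ≡⟨ sym (+-assoc a (suc (b ∸ a)) _) ⟩
    a + suc (b ∸ a) + (L ∸ suc b)
  ≡⟨ cong (_+ (L ∸ suc b)) (trans (+-suc a _) (cong suc (m+[n∸m]≡n a≤b))) ⟩
    suc b + (L ∸ suc b)
  ≡⟨ m+[n∸m]≡n b<L ⟩
    L
  ∎
  where open ≡-Reasoning

∑<-indicator-≡ : ∀ M q → q < M → ∑< (λ k → indicator (k ≟ q)) M ≡ 1
∑<-indicator-≡ (suc M) zero    _ = cong suc (∑<-zero M (λ i _ → indicator-no (suc i ≟ 0) (λ ())))
∑<-indicator-≡ (suc M) (suc q) (s≤s lt) =
  trans (∑<-cong M (λ i _ → indicator-cong (suc i ≟ suc q) (i ≟ q) suc-injective (cong suc)))
        (∑<-indicator-≡ M q lt)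

count-threshold : (P : ℕ → Set) (P? : ∀ i → Dec (P i)) → (∀ i → P (suc i) → P i) →
  ∀ L → (∀ i → P i → i < L) →
  ∀ k → (k < ∑< (λ i → indicator (P? i)) L → P k) × (P k → k < ∑< (λ i → indicator (P? i)) L)
count-threshold P P? down zero bound k = (λ ()) , (λ pk → ⊥-elim (n≮0 (bound k pk)))
count-threshold P P? down (suc L) bound k with P? 0
... | no ¬p0 = (λ lt → ⊥-elim (n≮0 (≤-trans lt (≤-reflexive none))))
             , (λ pk → ⊥-elim (¬p0 (to0 k pk)))
  where
  to0 : ∀ k → P k → P 0
  to0 zero    p = p
  to0 (suc k) p = to0 k (down k p)
  none : ∑< (λ i → indicator (P? (suc i))) L ≡ 0
  none = ∑<-zero L (λ i _ → indicator-no (P? (suc i)) (λ p → ¬p0 (to0 (suc i) p)))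
... | yes p0 = to k , from k
  where
  shifted = count-threshold (λ i → P (suc i)) (λ i → P? (suc i)) (λ i → down (suc i)) L
              (λ i p → ≤-pred (bound (suc i) p))
  to : ∀ k → k < suc (∑< (λ i → indicator (P? (suc i))) L) → P k
  to zero    _        = p0
  to (suc k) (s≤s lt) = proj₁ (shifted k) lt
  from : ∀ k → P k → k < suc (∑< (λ i → indicator (P? (suc i))) L)
  from zero    _ = s≤s z≤n
  from (suc k) p = s≤s (proj₂ (shifted k) p)

<-extensional : ∀ {A B} → (∀ k → k < A → k < B) → (∀ k → k < B → k < A) → A ≡ B
<-extensional {A} {B} f g with <-cmp A B
... | tri< a _ _ = ⊥-elim (<-irrefl refl (g A a))
... | tri≈ _ e _ = e
... | tri> _ _ c = ⊥-elim (<-irrefl refl (f B c))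

least-witness : (P : ℕ → Set) (P? : ∀ i → Dec (P i)) → ∀ n → P n →
  Σ ℕ λ a → P a × (∀ i → i < a → ¬ P i)
least-witness P P? n pn with P? 0
... | yes p0 = 0 , p0 , (λ i ())
least-witness P P? zero    pn | no ¬p0 = ⊥-elim (¬p0 pn)
least-witness P P? (suc n) pn | no ¬p0
  with least-witness (λ i → P (suc i)) (λ i → P? (suc i)) n pn
... | a , pa , below = suc a , pa , below′
  where
  below′ : ∀ i → i < suc a → ¬ P i
  below′ zero    _        = ¬p0
  below′ (suc i) (s≤s lt) = below i lt

greatest-witness : (P : ℕ → Set) (P? : ∀ i → Dec (P i)) → ∀ L → (∀ i → P i → i < L) → ∀ n → P n →
  Σ ℕ λ b → P b × (∀ i → b < i → ¬ P i)
greatest-witness P P? zero    bound n pn = ⊥-elim (n≮0 (bound n pn))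
greatest-witness P P? (suc L) bound n pn with P? L
... | yes pL = L , pL , (λ i lt pi → ⊥-elim (<-irrefl refl (≤-trans (bound i pi) lt)))
... | no ¬pL = greatest-witness P P? L bound′ n pn
  where
  bound′ : ∀ i → P i → i < L
  bound′ i pi with m≤n⇒m<n∨m≡n (≤-pred (bound i pi))
  ... | inj₁ lt   = lt
  ... | inj₂ refl = ⊥-elim (¬pL pi)

∸-pred-suc : ∀ m n → n < m → m ∸ n ≡ suc (m ∸ suc n)
∸-pred-suc (suc m) zero    _        = refl
∸-pred-suc (suc m) (suc n) (s≤s lt) = ∸-pred-suc m n lt

∸-shift : ∀ m a d → a + d < m → m ∸ suc a ≡ d + (m ∸ suc (a + d))
∸-shift m a zero    lt = cong (λ z → m ∸ suc z) (sym (+-identityʳ a))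
∸-shift m a (suc d) lt = trans (∸-shift m a d (≤-trans (s≤s (+-monoʳ-≤ a (n≤1+n d))) lt))
  (trans (cong (d +_) (∸-pred-suc m (suc (a + d)) (subst (_< m) (+-suc a d) lt)))
    (trans (+-suc d _) (cong (λ z → suc d + (m ∸ suc z)) (sym (+-suc a d)))))

pred< : ∀ {a b} → 0 < a → a ≤ b → pred a < b
pred< {suc a} _ (s≤s le) = s≤s le

nth-suc-≤ : ∀ xs → Linked _≥_ xs → ∀ i → nth xs (suc i) ≤ nth xs i
nth-suc-≤ []           _         i       = z≤n
nth-suc-≤ (x ∷ [])     _         i       = z≤n
nth-suc-≤ (x ∷ y ∷ xs) (x≥y ∷ l) zero    = x≥y
nth-suc-≤ (x ∷ y ∷ xs) (x≥y ∷ l) (suc i) = nth-suc-≤ (y ∷ xs) l i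

nth-beyond : ∀ xs i → length xs ≤ i → nth xs i ≡ 0
nth-beyond []       i       _        = refl
nth-beyond (x ∷ xs) (suc i) (s≤s le) = nth-beyond xs i le

nth-pos : ∀ xs → All (0 <_) xs → ∀ i → i < length xs → 0 < nth xs i
nth-pos (x ∷ xs) (p ∷ _)  zero    _        = p
nth-pos (x ∷ xs) (_ ∷ ps) (suc i) (s≤s lt) = nth-pos xs ps i lt

nth-applyUpTo : ∀ (f : ℕ → ℕ) k i → i < k → nth (applyUpTo f k) i ≡ f i
nth-applyUpTo f (suc k) zero    _        = refl
nth-applyUpTo f (suc k) (suc i) (s≤s lt) = nth-applyUpTo (λ j → f (suc j)) k i lt

row-suc-≤ : ∀ p i → row p (suc i) ≤ row p i
row-suc-≤ p i = nth-suc-≤ (parts p) (decr p) i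

row-antitone : ∀ p {i j} → i ≤ j → row p j ≤ row p i
row-antitone p {i} {j} le with m≤n⇒m<n∨m≡n le
... | inj₂ refl = ≤-refl
... | inj₁ lt with j
...   | suc j′ = ≤-trans (row-suc-≤ p j′) (row-antitone p (≤-pred lt))

row-beyond : ∀ p i → len p ≤ i → row p i ≡ 0
row-beyond p i le = nth-beyond (parts p) i le

row-pos : ∀ p i → i < len p → 0 < row p i
row-pos p i lt = nth-pos (parts p) (pos p) i lt

row-pos⇒<len : ∀ p i → 0 < row p i → i < len p
row-pos⇒<len p i h with i <? len p
... | yes lt = lt
... | no nlt = ⊥-elim (<-irrefl (sym (row-beyond p i (≮⇒≥ nlt))) h)

length-filter-applyUpTo : ∀ {P : ℕ → Set} (P? : ∀ x → Dec (P x)) (g : ℕ → ℕ) k →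
  length (filter P? (applyUpTo g k)) ≡ ∑< (λ j → indicator (P? (g j))) k
length-filter-applyUpTo P? g zero = refl
length-filter-applyUpTo P? g (suc k) with P? (g 0)
... | yes _ = cong suc (length-filter-applyUpTo P? (λ j → g (suc j)) k)
... | no _  = length-filter-applyUpTo P? (λ j → g (suc j)) k

length-filter≡∑< : ∀ {P : ℕ → Set} (P? : ∀ x → Dec (P x)) xs →
  length (filter P? xs) ≡ ∑< (λ j → indicator (P? (nth xs j))) (length xs)
length-filter≡∑< P? [] = refl
length-filter≡∑< P? (x ∷ xs) with P? x
... | yes _ = cong suc (length-filter≡∑< P? xs)
... | no _  = length-filter≡∑< P? xs

sum-applyUpTo : ∀ (f : ℕ → ℕ) k → sum (applyUpTo f k) ≡ ∑< f k
sum-applyUpTo f zero    = refl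
sum-applyUpTo f (suc k) = cong (f 0 +_) (sum-applyUpTo (λ j → f (suc j)) k)

betaAt : Partition → ℕ → ℕ → ℕ
betaAt p m j = row p j + (m ∸ suc j)

residueCount : (t : ℕ) → {{NonZero t}} → Partition → ℕ → ℕ → ℕ
residueCount t p m i = ∑< (λ j → indicator ((betaAt p m j % t) ≟ i)) m

nCount≡residueCount : ∀ t {{_ : NonZero t}} p m i → nCount t p m i ≡ residueCount t p m i
nCount≡residueCount t p m i =
  trans (cong (λ l → length (filter (λ b → (b % t) ≟ i) l)) (map-upTo (betaAt p m) m))
        (length-filter-applyUpTo (λ b → (b % t) ≟ i) (betaAt p m) m)

conj≡∑< : ∀ p c → conj p c ≡ ∑< (λ k → indicator (c ≤? row p k)) (len p)
conj≡∑< p c = length-filter≡∑< (λ x → c ≤? x) (parts p)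

skewSize≡∑< : ∀ la μ → skewSize la μ ≡ ∑< (λ i → row la i ∸ row μ i) (len la)
skewSize≡∑< la μ = trans (cong sum (map-upTo (λ i → row la i ∸ row μ i) (len la)))
  (sum-applyUpTo _ (len la))

module FromRows (ν : ℕ → ℕ) (ν-suc-≤ : ∀ i → ν (suc i) ≤ ν i)
                (L : ℕ) (ν-beyond : ∀ i → L ≤ i → ν i ≡ 0) where
  rowCount : ℕ
  rowCount = ∑< (λ i → indicator (1 ≤? ν i)) L

  pos⇔<rowCount : ∀ k → (k < rowCount → 0 < ν k) × (0 < ν k → k < rowCount)
  pos⇔<rowCount = count-threshold (λ i → 0 < ν i) (λ i → 1 ≤? ν i) (λ i h → ≤-trans h (ν-suc-≤ i)) L bound
    where
    bound : ∀ i → 0 < ν i → i < L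
    bound i h with i <? L
    ... | yes lt = lt
    ... | no nlt = ⊥-elim (<-irrefl (sym (ν-beyond i (≮⇒≥ nlt))) h)

  partition : Partition
  partition = record
    { parts = applyUpTo ν rowCount
    ; decr  = Linkedₚ.applyUpTo⁺₂ ν rowCount ν-suc-≤
    ; pos   = Allₚ.applyUpTo⁺₁ ν rowCount (λ {i} lt → proj₁ (pos⇔<rowCount i) lt)
    }

  row-partition : ∀ i → row partition i ≡ ν i
  row-partition i with i <? rowCount
  ... | yes lt = nth-applyUpTo ν rowCount i lt
  ... | no nlt = trans (nth-beyond (applyUpTo ν rowCount) i (subst (_≤ i) (sym (length-applyUpTo ν rowCount)) (≮⇒≥ nlt)))
                       (sym (n≤0⇒n≡0 (≮⇒≥ (λ h → nlt (proj₂ (pos⇔<rowCount i) h)))))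

path-crosses-row : ∀ la μ {i j i′ j′} → Star (SkewStep la μ) (i , j) (i′ , j′) →
  ∀ k → i ≤ k → k < i′ → Σ ℕ λ c → InSkew la μ (k , c) × InSkew la μ (suc k , c)
path-crosses-row la μ ε k i≤k k<i′ = ⊥-elim (<-irrefl refl (≤-trans k<i′ i≤k))
path-crosses-row la μ {j = j} (_◅_ {j = (i₁ , _)} (adj , here , there) rest) k i≤k k<i′ with i₁ ≤? k
... | yes i₁≤k = path-crosses-row la μ rest k i₁≤k k<i′
... | no i₁≰k with adj
...   | inj₁ (refl , _)         = ⊥-elim (i₁≰k i≤k)
...   | inj₂ (refl , inj₂ refl) = ⊥-elim (i₁≰k (≤-trans (n≤1+n i₁) i≤k))
...   | inj₂ (refl , inj₁ refl) with ≤-antisym i≤k (≤-pred (≰⇒> i₁≰k))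
...     | refl = j , here , there

-- The strip λ/μ occupies exactly the rows a, …, b, and consecutive rows of it
-- overlap in one column: λ_{k+1} = μ_k + 1 for a ≤ k < b.  Hence
-- β_b(μ) + t = β_a(λ) and β_k(μ) = β_{k+1}(λ) for a ≤ k < b, while all other
-- entries agree: the residues mod t are only permuted.
module StripRemoval (t : ℕ) {{_ : NonZero t}} (la μ : Partition) (strip : RemoveStrip t la μ) where
  λr μr : ℕ → ℕ
  λr = row la
  μr = row μ

  μ⊆λ : ∀ i → μr i ≤ λr i
  μ⊆λ = proj₁ strip

  size : skewSize la μ ≡ t
  size = proj₂ (proj₂ (proj₂ strip))

  len-≤ : len μ ≤ len la
  len-≤ = ≮⇒≥ (λ lt → <-irrefl refl (≤-trans (row-pos μ (len la) lt)
              (≤-trans (μ⊆λ (len la)) (≤-reflexive (row-beyond la (len la) ≤-refl)))))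

  Touched : ℕ → Set
  Touched i = μr i < λr i

  untouched : ∀ i → ¬ Touched i → μr i ≡ λr i
  untouched i ¬touched = ≤-antisym (μ⊆λ i) (≮⇒≥ ¬touched)

  some-touched : Σ ℕ Touched
  some-touched with ∑<-pos⇒term _ (len la) (subst (0 <_) (trans (sym size) (skewSize≡∑< la μ)) (>-nonZero⁻¹ t))
  ... | i , _ , h = i , m∸n≢0⇒n<m (λ eq → <-irrefl (sym eq) h)

  first = least-witness Touched (λ i → μr i <? λr i) (proj₁ some-touched) (proj₂ some-touched)
  a : ℕ
  a = proj₁ first
  touched-a : Touched a
  touched-a = proj₁ (proj₂ first)
  untouched-<a : ∀ i → i < a → ¬ Touched i
  untouched-<a = proj₂ (proj₂ first)

  last = greatest-witness Touched (λ i → μr i <? λr i) (len la)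
           (λ i h → row-pos⇒<len la i (≤-trans (s≤s z≤n) h)) a touched-a
  b : ℕ
  b = proj₁ last
  touched-b : Touched b
  touched-b = proj₁ (proj₂ last)
  untouched->b : ∀ i → b < i → ¬ Touched i
  untouched->b = proj₂ (proj₂ last)

  a≤b : a ≤ b
  a≤b = ≮⇒≥ (λ lt → untouched-<a b lt touched-b)

  b<len : b < len la
  b<len = row-pos⇒<len la b (≤-trans (s≤s z≤n) touched-b)

  d : ℕ
  d = b ∸ a

  b≡a+d : b ≡ a + d
  b≡a+d = sym (m+[n∸m]≡n a≤b)

  beyond-b : ∀ i → b < a + (suc d + i)
  beyond-b i = subst (_< a + (suc d + i)) (sym b≡a+d) (+-monoʳ-< a (s≤s (m≤m+n d i)))

  λ-suc≤μ+1 : ∀ k → μr k < λr (suc k) → λr (suc k) ≤ suc (μr k)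
  λ-suc≤μ+1 k μk<λsk with λr (suc k) ≤? suc (μr k)
  ... | yes le = le
  ... | no nle = ⊥-elim (proj₁ (proj₂ (proj₂ strip)) k (μr k) (c₀₀ , c₁₀ , c₀₁ , c₁₁))
    where
    wide : suc (suc (μr k)) ≤ λr (suc k)
    wide = ≰⇒> nle
    c₀₀ : InSkew la μ (k , μr k)
    c₀₀ = ≤-trans μk<λsk (row-suc-≤ la k) , ≤-refl
    c₁₀ : InSkew la μ (suc k , μr k)
    c₁₀ = μk<λsk , row-suc-≤ μ k
    c₀₁ : InSkew la μ (k , suc (μr k))
    c₀₁ = ≤-trans wide (row-suc-≤ la k) , n≤1+n _
    c₁₁ : InSkew la μ (suc k , suc (μr k))
    c₁₁ = wide , ≤-trans (row-suc-≤ μ k) (n≤1+n _)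

  λ-suc≡μ+1 : ∀ k → a ≤ k → k < b → λr (suc k) ≡ suc (μr k)
  λ-suc≡μ+1 k a≤k k<b
    with path-crosses-row la μ (proj₁ (proj₂ strip) (a , μr a) (b , μr b) (touched-a , ≤-refl) (touched-b , ≤-refl)) k a≤k k<b
  ... | c , (_ , μk≤c) , (c<λsk , _) =
    let μk<λsk = ≤-<-trans μk≤c c<λsk in ≤-antisym (λ-suc≤μ+1 k μk<λsk) μk<λsk

  δ : ℕ → ℕ
  δ i = λr i ∸ μr i

  δ-untouched : ∀ i → ¬ Touched i → δ i ≡ 0
  δ-untouched i ¬touched = trans (cong (λr i ∸_) (untouched i ¬touched)) (n∸n≡0 (λr i))

  telescope : ∀ k → k ≤ d → ∑< (λ i → δ (a + i)) (suc k) + μr (a + k) ≡ λr a + k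
  telescope zero _ rewrite +-identityʳ a | +-identityʳ (δ a) | +-identityʳ (λr a) = m∸n+n≡m (μ⊆λ a)
  telescope (suc k) le = begin
      Δ (suc (suc k)) + μr (a + suc k)
    ≡⟨ cong (_+ μr (a + suc k)) (∑<-snoc (λ i → δ (a + i)) (suc k)) ⟩
      Δ (suc k) + δ (a + suc k) + μr (a + suc k)
    ≡⟨ +-assoc (Δ (suc k)) _ _ ⟩
      Δ (suc k) + (δ (a + suc k) + μr (a + suc k))
    ≡⟨ cong (Δ (suc k) +_) (m∸n+n≡m (μ⊆λ (a + suc k))) ⟩
      Δ (suc k) + λr (a + suc k)
    ≡⟨ cong (λ z → Δ (suc k) + λr z) (+-suc a k) ⟩
      Δ (suc k) + λr (suc (a + k))
    ≡⟨ cong (Δ (suc k) +_) (λ-suc≡μ+1 (a + k) (m≤m+n a k) a+k<b) ⟩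
      Δ (suc k) + suc (μr (a + k))
    ≡⟨ +-suc _ _ ⟩
      suc (Δ (suc k) + μr (a + k))
    ≡⟨ cong suc (telescope k (≤-trans (n≤1+n k) le)) ⟩
      suc (λr a + k)
    ≡⟨ sym (+-suc (λr a) k) ⟩
      λr a + suc k
    ∎
    where
    open ≡-Reasoning
    Δ : ℕ → ℕ
    Δ = ∑< (λ i → δ (a + i))
    a+k<b : a + k < b
    a+k<b = subst (a + k <_) (sym b≡a+d) (+-monoʳ-< a le)

  t≡∑δ : t ≡ ∑< (λ i → δ (a + i)) (suc d)
  t≡∑δ = begin
      t
    ≡⟨ trans (sym size) (skewSize≡∑< la μ) ⟩
      ∑< δ (len la)
    ≡⟨ cong (∑< δ) (sym (window a≤b b<len)) ⟩
      ∑< δ (a + (suc d + (len la ∸ suc b)))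
    ≡⟨ ∑<-window δ a (suc d) _ (λ i lt → δ-untouched i (untouched-<a i lt))
                                (λ i → δ-untouched _ (untouched->b _ (beyond-b i))) ⟩
      ∑< (λ i → δ (a + i)) (suc d)
    ∎
    where open ≡-Reasoning

  t+μb≡λa+d : t + μr b ≡ λr a + d
  t+μb≡λa+d = trans (cong₂ _+_ t≡∑δ (cong μr b≡a+d)) (telescope d ≤-refl)

  module _ (m : ℕ) (len≤m : len la ≤ m) where
    b<m : b < m
    b<m = ≤-trans b<len len≤m

    beta-b+t : betaAt μ m b + t ≡ betaAt la m a
    beta-b+t = begin
        μr b + (m ∸ suc b) + t
      ≡⟨ solve 3 (λ x y z → x :+ y :+ z := z :+ x :+ y) refl (μr b) (m ∸ suc b) t ⟩
        t + μr b + (m ∸ suc b)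
      ≡⟨ cong₂ _+_ t+μb≡λa+d (cong (λ z → m ∸ suc z) b≡a+d) ⟩
        λr a + d + (m ∸ suc (a + d))
      ≡⟨ +-assoc (λr a) d _ ⟩
        λr a + (d + (m ∸ suc (a + d)))
      ≡⟨ cong (λr a +_) (sym (∸-shift m a d (subst (_< m) b≡a+d b<m))) ⟩
        λr a + (m ∸ suc a)
      ∎
      where open ≡-Reasoning

    beta-shift : ∀ j → j < d → betaAt μ m (a + j) ≡ betaAt la m (a + suc j)
    beta-shift j j<d = begin
        μr (a + j) + (m ∸ suc (a + j))
      ≡⟨ cong (μr (a + j) +_) (∸-pred-suc m (suc (a + j)) (≤-<-trans a+j<b b<m)) ⟩
        μr (a + j) + suc (m ∸ suc (suc (a + j)))
      ≡⟨ +-suc _ _ ⟩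
        suc (μr (a + j)) + (m ∸ suc (suc (a + j)))
      ≡⟨ cong₂ (λ u v → u + (m ∸ suc v)) (sym (λ-suc≡μ+1 (a + j) (m≤m+n a j) a+j<b)) (sym (+-suc a j)) ⟩
        λr (suc (a + j)) + (m ∸ suc (a + suc j))
      ≡⟨ cong (λ z → λr z + (m ∸ suc (a + suc j))) (sym (+-suc a j)) ⟩
        λr (a + suc j) + (m ∸ suc (a + suc j))
      ∎
      where
      open ≡-Reasoning
      a+j<b : a + j < b
      a+j<b = subst (a + j <_) (sym b≡a+d) (+-monoʳ-< a j<d)

    beta-untouched : ∀ j → ¬ Touched j → betaAt μ m j ≡ betaAt la m j
    beta-untouched j ¬touched = cong (_+ (m ∸ suc j)) (untouched j ¬touched)

    residueCount-≡ : ∀ r → residueCount t μ m r ≡ residueCount t la m r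
    residueCount-≡ r =
      subst (λ z → ∑< gμ z ≡ ∑< gλ z) (window a≤b b<m)
        (∑<-cong-window gμ gλ a (suc d) _
          (λ j lt → cong hit (beta-untouched j (untouched-<a j lt)))
          (λ j → cong hit (beta-untouched _ (untouched->b _ (beyond-b j))))
          (∑<-rotate (λ i → gμ (a + i)) (λ i → gλ (a + i)) d
            (λ j lt → cong hit (beta-shift j lt)) wrap))
      where
      hit : ℕ → ℕ
      hit x = indicator ((x % t) ≟ r)
      gμ gλ : ℕ → ℕ
      gμ j = hit (betaAt μ m j)
      gλ j = hit (betaAt la m j)
      wrap : gμ (a + d) ≡ gλ (a + 0)
      wrap = cong (λ z → indicator (z ≟ r)) (begin
          betaAt μ m (a + d) % t
        ≡⟨ cong (λ z → betaAt μ m z % t) (sym b≡a+d) ⟩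
          betaAt μ m b % t
        ≡⟨ sym ([m+n]%n≡m%n (betaAt μ m b) t) ⟩
          (betaAt μ m b + t) % t
        ≡⟨ cong (λ z → z % t) (trans beta-b+t (cong (betaAt la m) (sym (+-identityʳ a)))) ⟩
          betaAt la m (a + 0) % t
        ∎)
        where open ≡-Reasoning

strips-preserve-residueCount : ∀ t {{_ : NonZero t}} m {la μ} → Star (RemoveStrip t) la μ → len la ≤ m →
  len μ ≤ m × (∀ r → residueCount t μ m r ≡ residueCount t la m r)
strips-preserve-residueCount t m ε              len≤m = len≤m , (λ r → refl)
strips-preserve-residueCount t m {la} (_◅_ {j = ν} strip rest) len≤m
  with strips-preserve-residueCount t m rest (≤-trans (StripRemoval.len-≤ t la ν strip) len≤m)
... | len′≤m , same = len′≤m , (λ r → trans (same r) (StripRemoval.residueCount-≡ t la ν strip m len≤m r))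

module BetaNumbers (μ : Partition) (m : ℕ) (len≤m : len μ ≤ m) where
  β : ℕ → ℕ
  β = betaAt μ m

  row-beyond-m : ∀ i → m ≤ i → row μ i ≡ 0
  row-beyond-m i le = row-beyond μ i (≤-trans len≤m le)

  β-suc-< : ∀ i → suc i < m → β (suc i) < β i
  β-suc-< i lt =
    subst (β (suc i) <_) (sym (trans (cong (row μ i +_) (∸-pred-suc m (suc i) lt)) (+-suc (row μ i) _)))
      (s≤s (+-monoˡ-≤ (m ∸ suc (suc i)) (row-suc-≤ μ i)))

  β-beyond : ∀ i → m ≤ i → β i ≡ 0
  β-beyond i le = cong₂ _+_ (row-beyond-m i le) (m≤n⇒m∸n≡0 (≤-trans le (n≤1+n i)))

  β-pos⇒<m : ∀ i → 0 < β i → i < m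
  β-pos⇒<m i h with i <? m
  ... | yes lt = lt
  ... | no nlt = ⊥-elim (<-irrefl (sym (β-beyond i (≮⇒≥ nlt))) h)

  β-suc-≤ : ∀ i → β (suc i) ≤ β i
  β-suc-≤ i with suc i <? m
  ... | yes lt = <⇒≤ (β-suc-< i lt)
  ... | no nlt = ≤-trans (≤-reflexive (β-beyond (suc i) (≮⇒≥ nlt))) z≤n

  β-antitone : ∀ {i i′} → i ≤ i′ → β i′ ≤ β i
  β-antitone {i} {i′} le with m≤n⇒m<n∨m≡n le
  ... | inj₂ refl = ≤-refl
  ... | inj₁ lt with i′
  ...   | suc i″ = ≤-trans (β-suc-≤ i″) (β-antitone (≤-pred lt))

  offset≤β : ∀ i → m ∸ suc i ≤ β i
  offset≤β i = m≤n+m (m ∸ suc i) (row μ i)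

  #≥ : ℕ → ℕ
  #≥ w = ∑< (λ q → indicator (w ≤? β q)) m

  bead : ℕ → ℕ
  bead w = ∑< (λ q → indicator (β q ≟ w)) m

  #≥-split : ∀ w → #≥ w ≡ #≥ (suc w) + bead w
  #≥-split w = trans (∑<-cong m (λ q _ → split (β q))) (∑<-+ _ _ m)
    where
    split : ∀ x → indicator (w ≤? x) ≡ indicator (suc w ≤? x) + indicator (x ≟ w)
    split x with <-cmp w x
    ... | tri< w<x _ _ = trans (indicator-yes (w ≤? x) (<⇒≤ w<x))
        (cong₂ _+_ (sym (indicator-yes (suc w ≤? x) w<x)) (sym (indicator-no (x ≟ w) (λ eq → <-irrefl (sym eq) w<x))))
    ... | tri≈ _ refl _ = trans (indicator-yes (w ≤? w) ≤-refl)
        (cong₂ _+_ (sym (indicator-no (suc w ≤? w) (<-irrefl refl))) (sym (indicator-yes (w ≟ w) refl)))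
    ... | tri> _ _ x<w = trans (indicator-no (w ≤? x) (<⇒≱ x<w))
        (cong₂ _+_ (sym (indicator-no (suc w ≤? x) (λ h → <⇒≱ x<w (<⇒≤ h)))) (sym (indicator-no (x ≟ w) (λ eq → <-irrefl eq x<w))))

  #≥0≡m : #≥ 0 ≡ m
  #≥0≡m = trans (∑<-cong m (λ q _ → indicator-yes (0 ≤? β q) z≤n)) (∑<-1 m)

  #≥≤m : ∀ w → #≥ w ≤ m
  #≥≤m w = subst (#≥ w ≤_) (∑<-1 m) (∑<-mono m (λ q _ → indicator≤1 (w ≤? β q)))

  #≥-antitone : ∀ {w w′} → w ≤ w′ → #≥ w′ ≤ #≥ w
  #≥-antitone {w} {w′} le = ∑<-mono m (λ q _ → mono (β q))
    where
    mono : ∀ x → indicator (w′ ≤? x) ≤ indicator (w ≤? x)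
    mono x with w′ ≤? x
    ... | yes h = ≤-reflexive (sym (indicator-yes (w ≤? x) (≤-trans le h)))
    ... | no _  = z≤n

  <#≥-suc⇔ : ∀ w q → (q < #≥ (suc w) → suc w ≤ β q) × (suc w ≤ β q → q < #≥ (suc w))
  <#≥-suc⇔ w = count-threshold (λ q → suc w ≤ β q) (λ q → suc w ≤? β q) (λ i h → ≤-trans h (β-suc-≤ i)) m
                 (λ i h → β-pos⇒<m i (≤-trans (s≤s z≤n) h))

  <#≥⇔ : ∀ w q → q < m → (q < #≥ w → w ≤ β q) × (w ≤ β q → q < #≥ w)
  <#≥⇔ zero    q lt = (λ _ → z≤n) , (λ _ → subst (q <_) (sym #≥0≡m) lt)
  <#≥⇔ (suc w) q lt = <#≥-suc⇔ w q

  β⇒bead : ∀ q w → q < m → β q ≡ w → 1 ≤ bead w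
  β⇒bead q w lt eq = ≤-trans (≤-reflexive (sym (indicator-yes (β q ≟ w) eq))) (term≤∑< (λ q → indicator (β q ≟ w)) m q lt)

  bead⇒β : ∀ w → 1 ≤ bead w → Σ ℕ λ q → q < m × β q ≡ w
  bead⇒β w h with ∑<-pos⇒term _ m h
  ... | q , lt , p = q , lt , indicator-pos⇒ (β q ≟ w) p

  -- Two beads at w would be β_q and β_{q+1} for q = #≥ (w + 1), but β is
  -- strictly decreasing.
  bead≤1 : ∀ w → bead w ≤ 1
  bead≤1 w with 2 ≤? bead w
  ... | no ¬two = ≤-pred (≰⇒> ¬two)
  ... | yes two = ⊥-elim (<-irrefl (trans (β≡w (suc q) sq<m sq<#≥w (λ h → <-irrefl refl (<-trans (n<1+n q) h)))
                                         (sym (β≡w q (<-trans (n<1+n q) sq<m) q<#≥w (<-irrefl refl))))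
                                  (β-suc-< q sq<m))
    where
    q = #≥ (suc w)
    q<#≥w : q < #≥ w
    q<#≥w = subst (q <_) (sym (#≥-split w)) (m<m+n q (≤-trans (s≤s z≤n) two))
    sq<#≥w : suc q < #≥ w
    sq<#≥w = subst (suc q <_) (sym (#≥-split w)) (subst (_≤ q + bead w) (+-comm q 2) (+-monoʳ-≤ q two))
    sq<m : suc q < m
    sq<m = <-≤-trans sq<#≥w (#≥≤m w)
    β≡w : ∀ p → p < m → p < #≥ w → ¬ (p < #≥ (suc w)) → β p ≡ w
    β≡w p lt h ¬h = ≤-antisym (≮⇒≥ (λ h′ → ¬h (proj₂ (<#≥-suc⇔ w p) h′))) (proj₁ (<#≥⇔ w p lt) h)

-- Moving the bead β_j down to an empty position y = β_j − t removes a rim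
-- hook of size t.  If k is the last row with β_k > y, the new rows are
-- ν_i = μ_{i+1} − 1 for j ≤ i < k, ν_k = y − (m − 1 − k), and ν_i = μ_i
-- otherwise.
module LowerBead (t : ℕ) {{_ : NonZero t}} (μ : Partition) (m : ℕ) (len≤m : len μ ≤ m)
                (j : ℕ) (t≤βj : t ≤ betaAt μ m j) (gap : ∀ i → i < m → betaAt μ m i ≢ betaAt μ m j ∸ t) where
  open BetaNumbers μ m len≤m

  μr : ℕ → ℕ
  μr = row μ

  y : ℕ
  y = β j ∸ t

  y<βj : y < β j
  y<βj = ∸-monoʳ-< {β j} {t} {0} (>-nonZero⁻¹ t) t≤βj

  above : ℕ
  above = #≥ (suc y)

  <above⇔y<β : ∀ i → (i < above → y < β i) × (y < β i → i < above)
  <above⇔y<β = <#≥-suc⇔ y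

  j<above : j < above
  j<above = proj₂ (<above⇔y<β j) y<βj

  k : ℕ
  k = pred above

  above≡1+k : above ≡ suc k
  above≡1+k = sym (suc-pred above {{>-nonZero (≤-<-trans z≤n j<above)}})

  j≤k : j ≤ k
  j≤k = ≤-pred (subst (j <_) above≡1+k j<above)

  y<βk : y < β k
  y<βk = proj₁ (<above⇔y<β k) (subst (k <_) (sym above≡1+k) (n<1+n k))

  k<m : k < m
  k<m = β-pos⇒<m k (≤-<-trans z≤n y<βk)

  β<y : ∀ i → k < i → i < m → β i < y
  β<y i k<i i<m with β i ≤? y
  ... | no β≰y = ⊥-elim (<-irrefl refl (≤-trans (proj₂ (<above⇔y<β i) (≰⇒> β≰y)) (subst (_≤ i) (sym above≡1+k) k<i)))
  ... | yes β≤y with m≤n⇒m<n∨m≡n β≤y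
  ...   | inj₁ lt = lt
  ...   | inj₂ eq = ⊥-elim (gap i i<m eq)

  offset : ℕ
  offset = m ∸ suc k

  v : ℕ
  v = y ∸ offset

  offset≤y : offset ≤ y
  offset≤y with suc k <? m
  ... | yes lt = subst (_≤ y) (sym (∸-pred-suc m (suc k) lt)) (≤-<-trans (offset≤β (suc k)) (β<y (suc k) (n<1+n k) lt))
  ... | no nlt = subst (_≤ y) (sym (m≤n⇒m∸n≡0 (≮⇒≥ nlt))) z≤n

  v+offset≡y : v + offset ≡ y
  v+offset≡y = m∸n+n≡m offset≤y

  v<μk : v < μr k
  v<μk = +-cancelʳ-< offset v (μr k) (subst (_< μr k + offset) (sym v+offset≡y) y<βk)

  μ-suc-k≤v : μr (suc k) ≤ v
  μ-suc-k≤v with suc k <? m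
  ... | no nlt = subst (_≤ v) (sym (row-beyond-m (suc k) (≮⇒≥ nlt))) z≤n
  ... | yes lt = +-cancelʳ-≤ offset (μr (suc k)) v (subst (μr (suc k) + offset ≤_) (sym v+offset≡y) below)
    where
    below : μr (suc k) + offset ≤ y
    below = subst (λ z → μr (suc k) + z ≤ y) (sym (∸-pred-suc m (suc k) lt))
              (subst (_≤ y) (sym (+-suc (μr (suc k)) _)) (β<y (suc k) (n<1+n k) lt))

  μ-pos : ∀ i → i ≤ k → 0 < μr i
  μ-pos i le = ≤-<-trans z≤n (<-≤-trans v<μk (row-antitone μ le))

  ν : ℕ → ℕ
  ν i with i <? j
  ... | yes _ = μr i
  ... | no _ with i <? k
  ...   | yes _ = pred (μr (suc i))
  ...   | no _ with i ≟ k
  ...     | yes _ = v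
  ...     | no _  = μr i

  ν-<j : ∀ i → i < j → ν i ≡ μr i
  ν-<j i lt with i <? j
  ... | yes _ = refl
  ... | no ¬lt = ⊥-elim (¬lt lt)

  ν-hook : ∀ i → j ≤ i → i < k → ν i ≡ pred (μr (suc i))
  ν-hook i j≤i i<k with i <? j
  ... | yes i<j = ⊥-elim (<-irrefl refl (≤-trans i<j j≤i))
  ... | no _ with i <? k
  ...   | yes _   = refl
  ...   | no i≮k = ⊥-elim (i≮k i<k)

  ν-k : ν k ≡ v
  ν-k with k <? j
  ... | yes k<j = ⊥-elim (<-irrefl refl (≤-trans k<j j≤k))
  ... | no _ with k <? k
  ...   | yes k<k = ⊥-elim (<-irrefl refl k<k)
  ...   | no _ with k ≟ k
  ...     | yes _   = refl
  ...     | no k≢k = ⊥-elim (k≢k refl)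

  ν->k : ∀ i → k < i → ν i ≡ μr i
  ν->k i k<i with i <? j
  ... | yes _ = refl
  ... | no _ with i <? k
  ...   | yes i<k = ⊥-elim (<-irrefl refl (<-trans i<k k<i))
  ...   | no _ with i ≟ k
  ...     | yes refl = ⊥-elim (<-irrefl refl k<i)
  ...     | no _     = refl

  ν≤μ : ∀ i → ν i ≤ μr i
  ν≤μ i with i <? j
  ... | yes _ = ≤-refl
  ... | no _ with i <? k
  ...   | yes _ = ≤-trans pred[n]≤n (row-suc-≤ μ i)
  ...   | no _ with i ≟ k
  ...     | yes refl = <⇒≤ v<μk
  ...     | no _     = ≤-refl

  ν-suc-≤ : ∀ i → ν (suc i) ≤ ν i
  ν-suc-≤ i = by-cases (suc i <? j) (i <? j) (suc i <? k) (i <? k) (i ≟ k)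
    where
    by-cases : Dec (suc i < j) → Dec (i < j) → Dec (suc i < k) → Dec (i < k) → Dec (i ≡ k) → ν (suc i) ≤ ν i
    by-cases (yes si<j) _ _ _ _ =
      subst₂ _≤_ (sym (ν-<j (suc i) si<j)) (sym (ν-<j i (<-trans (n<1+n i) si<j))) (row-suc-≤ μ i)
    by-cases (no _) (yes i<j) _ _ _ =
      subst (ν (suc i) ≤_) (sym (ν-<j i i<j)) (≤-trans (ν≤μ (suc i)) (row-suc-≤ μ i))
    by-cases (no _) (no i≮j) (yes si<k) _ _ =
      subst₂ _≤_ (sym (ν-hook (suc i) (≤-trans (≮⇒≥ i≮j) (n≤1+n i)) si<k))
                 (sym (ν-hook i (≮⇒≥ i≮j) (<-trans (n<1+n i) si<k))) (pred-mono-≤ (row-suc-≤ μ (suc i)))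
    by-cases (no _) (no i≮j) (no si≮k) (yes i<k) _ =
      subst₂ _≤_ (sym (trans (cong ν si≡k) ν-k)) (sym (ν-hook i (≮⇒≥ i≮j) i<k))
                 (subst (λ z → v ≤ pred (μr z)) (sym si≡k) (pred-mono-≤ v<μk))
      where
      si≡k : suc i ≡ k
      si≡k = ≤-antisym i<k (≮⇒≥ si≮k)
    by-cases (no _) (no _) (no _) (no _) (yes refl) = subst₂ _≤_ (sym (ν->k (suc k) (n<1+n k))) (sym ν-k) μ-suc-k≤v
    by-cases (no _) (no _) (no _) (no i≮k) (no i≢k) =
      subst₂ _≤_ (sym (ν->k (suc i) (<-trans k<i (n<1+n i)))) (sym (ν->k i k<i)) (row-suc-≤ μ i)
      where
      k<i : k < i
      k<i = ≤∧≢⇒< (≮⇒≥ i≮k) (λ eq → i≢k (sym eq))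

  shortened⇒j≤i≤k : ∀ i → ν i < μr i → j ≤ i × i ≤ k
  shortened⇒j≤i≤k i lt = by-cases (i <? j) (k <? i)
    where
    by-cases : Dec (i < j) → Dec (k < i) → j ≤ i × i ≤ k
    by-cases (yes i<j) _         = ⊥-elim (<-irrefl (ν-<j i i<j) lt)
    by-cases (no _)    (yes k<i) = ⊥-elim (<-irrefl (ν->k i k<i) lt)
    by-cases (no i≮j)  (no k≮i)  = ≮⇒≥ i≮j , ≮⇒≥ k≮i

  module Rows = FromRows ν ν-suc-≤ (len μ) (λ i le → n≤0⇒n≡0 (≤-trans (ν≤μ i) (≤-reflexive (row-beyond μ i le))))

  smaller : Partition
  smaller = Rows.partition

  νr : ℕ → ℕ
  νr = row smaller

  νr≡ν : ∀ i → νr i ≡ ν i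
  νr≡ν = Rows.row-partition

  in-strip⇒j≤i≤k : ∀ i c → InSkew μ smaller (i , c) → j ≤ i × i ≤ k
  in-strip⇒j≤i≤k i c (c<μ , ν≤c) = shortened⇒j≤i≤k i (subst (_< μr i) (νr≡ν i) (≤-<-trans ν≤c c<μ))

  Step : Cell → Cell → Set
  Step = SkewStep μ smaller

  walk-left : ∀ i c → c < μr i → νr i ≤ c → Star Step (i , c) (i , νr i)
  walk-left i zero    c<μ ν≤c = subst (λ z → Star Step (i , 0) (i , z)) (sym (n≤0⇒n≡0 ν≤c)) ε
  walk-left i (suc c) c<μ ν≤c with νr i ≟ suc c
  ... | yes eq = subst (λ z → Star Step (i , suc c) (i , z)) (sym eq) ε
  ... | no ne  = (inj₁ (refl , inj₂ refl) , (c<μ , ν≤c) , (<-trans (n<1+n c) c<μ , ν≤c′))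
                 ◅ walk-left i c (<-trans (n<1+n c) c<μ) ν≤c′
    where
    ν≤c′ : νr i ≤ c
    ν≤c′ = ≤-pred (≤∧≢⇒< ν≤c ne)

  νr<μ-suc : ∀ i → j ≤ i → i < k → νr i < μr (suc i)
  νr<μ-suc i j≤i i<k = subst (_< μr (suc i)) (sym (trans (νr≡ν i) (ν-hook i j≤i i<k))) (pred< (μ-pos (suc i) i<k) ≤-refl)

  walk-to-corner : ∀ n i c → i + n ≡ k → j ≤ i → InSkew μ smaller (i , c) → Star Step (i , c) (k , νr k)
  walk-to-corner zero i c i≡k _ (c<μ , ν≤c) =
    subst (λ z → Star Step (i , c) (z , νr z)) (trans (sym (+-identityʳ i)) i≡k) (walk-left i c c<μ ν≤c)
  walk-to-corner (suc n) i c i+n≡k j≤i (c<μ , ν≤c) =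
    walk-left i c c<μ ν≤c ◅◅ (down ◅ walk-to-corner n (suc i) (νr i) (trans (sym (+-suc i n)) i+n≡k) (≤-trans j≤i (n≤1+n i)) below)
    where
    i<k : i < k
    i<k = subst (i <_) i+n≡k (≤-trans (≤-reflexive (sym (+-identityʳ (suc i)))) (subst (suc i + 0 ≤_) (sym (+-suc i n)) (s≤s (+-monoʳ-≤ i z≤n))))
    here : InSkew μ smaller (i , νr i)
    here = <-≤-trans (νr<μ-suc i j≤i i<k) (row-suc-≤ μ i) , ≤-refl
    below : InSkew μ smaller (suc i , νr i)
    below = νr<μ-suc i j≤i i<k , row-suc-≤ smaller i
    down : Step (i , νr i) (suc i , νr i)
    down = inj₂ (refl , inj₁ refl) , here , below

  adj-sym : ∀ {c d} → Adj c d → Adj d c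
  adj-sym (inj₁ (e , inj₁ x)) = inj₁ (sym e , inj₂ x)
  adj-sym (inj₁ (e , inj₂ x)) = inj₁ (sym e , inj₁ x)
  adj-sym (inj₂ (e , inj₁ x)) = inj₂ (sym e , inj₂ x)
  adj-sym (inj₂ (e , inj₂ x)) = inj₂ (sym e , inj₁ x)

  to-corner : ∀ i c → InSkew μ smaller (i , c) → Star Step (i , c) (k , νr k)
  to-corner i c h with in-strip⇒j≤i≤k i c h
  ... | j≤i , i≤k = walk-to-corner (k ∸ i) i c (m+[n∸m]≡n i≤k) j≤i h

  connected : Connected μ smaller
  connected (i , c) (i′ , c′) h h′ =
    to-corner i c h ◅◅ reverse (λ { (adj , s , s′) → adj-sym adj , s′ , s }) (to-corner i′ c′ h′)

  no2x2 : No2x2 μ smaller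
  no2x2 i c (h₀₀ , h₁₀ , _ , h₁₁) =
    <-irrefl refl (≤-<-trans (≤-trans (≤-reflexive (sym (suc-pred (μr (suc i)) {{>-nonZero μ-pos′}}))) (s≤s pred-μ≤c)) (proj₁ h₁₁))
    where
    i-range = in-strip⇒j≤i≤k i c h₀₀
    si-range = in-strip⇒j≤i≤k (suc i) c h₁₀
    μ-pos′ : 0 < μr (suc i)
    μ-pos′ = μ-pos (suc i) (proj₂ si-range)
    pred-μ≤c : pred (μr (suc i)) ≤ c
    pred-μ≤c = subst (_≤ c) (trans (νr≡ν i) (ν-hook i (proj₁ i-range) (proj₂ si-range))) (proj₂ h₀₀)

  δ : ℕ → ℕ
  δ i = μr i ∸ ν i

  e : ℕ
  e = k ∸ j

  k≡j+e : k ≡ j + e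
  k≡j+e = sym (m+[n∸m]≡n j≤k)

  telescope : ∀ l → l ≤ e → ∑< (λ i → δ (j + i)) l + μr (j + l) ≡ μr j + l
  telescope zero    _  = trans (cong μr (+-identityʳ j)) (sym (+-identityʳ (μr j)))
  telescope (suc l) le = begin
      Δ (suc l) + μr (j + suc l)
    ≡⟨ cong₂ _+_ (∑<-snoc (λ i → δ (j + i)) l) (cong μr (+-suc j l)) ⟩
      Δ l + δ (j + l) + μr (suc (j + l))
    ≡⟨ +-assoc (Δ l) _ _ ⟩
      Δ l + (δ (j + l) + μr (suc (j + l)))
    ≡⟨ cong (λ z → Δ l + ((μr (j + l) ∸ z) + μr (suc (j + l)))) (ν-hook (j + l) (m≤m+n j l) j+l<k) ⟩
      Δ l + ((μr (j + l) ∸ pred (μr (suc (j + l)))) + μr (suc (j + l)))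
    ≡⟨ cong (Δ l +_) (∸-pred+≡suc (μ-pos (suc (j + l)) j+l<k) (row-suc-≤ μ (j + l))) ⟩
      Δ l + suc (μr (j + l))
    ≡⟨ +-suc _ _ ⟩
      suc (Δ l + μr (j + l))
    ≡⟨ cong suc (telescope l (≤-trans (n≤1+n l) le)) ⟩
      suc (μr j + l)
    ≡⟨ sym (+-suc (μr j) l) ⟩
      μr j + suc l
    ∎
    where
    open ≡-Reasoning
    Δ : ℕ → ℕ
    Δ = ∑< (λ i → δ (j + i))
    j+l<k : j + l < k
    j+l<k = subst (j + l <_) (sym k≡j+e) (+-monoʳ-< j le)
    ∸-pred+≡suc : ∀ {a b} → 0 < b → b ≤ a → (a ∸ pred b) + b ≡ suc a
    ∸-pred+≡suc {a} {suc b} _ le = trans (+-suc (a ∸ b) b) (cong suc (m∸n+n≡m (≤-trans (n≤1+n b) le)))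

  v+t≡μj+e : v + t ≡ μr j + e
  v+t≡μj+e = +-cancelʳ-≡ offset (v + t) (μr j + e) (begin
      v + t + offset
    ≡⟨ solve 3 (λ a b c → a :+ b :+ c := a :+ c :+ b) refl v t offset ⟩
      v + offset + t
    ≡⟨ cong (_+ t) v+offset≡y ⟩
      y + t
    ≡⟨ m∸n+n≡m t≤βj ⟩
      μr j + (m ∸ suc j)
    ≡⟨ cong (μr j +_) (∸-shift m j e (subst (_< m) k≡j+e k<m)) ⟩
      μr j + (e + (m ∸ suc (j + e)))
    ≡⟨ sym (+-assoc (μr j) e _) ⟩
      μr j + e + (m ∸ suc (j + e))
    ≡⟨ cong (λ z → μr j + e + (m ∸ suc z)) (sym k≡j+e) ⟩
      μr j + e + offset
    ∎)
    where open ≡-Reasoning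

  ∑δ≡t : ∑< (λ i → δ (j + i)) (suc e) ≡ t
  ∑δ≡t = +-cancelʳ-≡ v _ t (begin
      Δ (suc e) + v
    ≡⟨ cong (_+ v) (∑<-snoc (λ i → δ (j + i)) e) ⟩
      Δ e + δ (j + e) + v
    ≡⟨ +-assoc (Δ e) _ v ⟩
      Δ e + (δ (j + e) + v)
    ≡⟨ cong (λ z → Δ e + ((μr z ∸ ν z) + v)) (sym k≡j+e) ⟩
      Δ e + ((μr k ∸ ν k) + v)
    ≡⟨ cong (λ z → Δ e + ((μr k ∸ z) + v)) ν-k ⟩
      Δ e + ((μr k ∸ v) + v)
    ≡⟨ cong (Δ e +_) (m∸n+n≡m (<⇒≤ v<μk)) ⟩
      Δ e + μr k
    ≡⟨ cong (λ z → Δ e + μr z) k≡j+e ⟩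
      Δ e + μr (j + e)
    ≡⟨ telescope e ≤-refl ⟩
      μr j + e
    ≡⟨ trans (sym v+t≡μj+e) (+-comm v t) ⟩
      t + v
    ∎)
    where
    open ≡-Reasoning
    Δ : ℕ → ℕ
    Δ = ∑< (λ i → δ (j + i))

  size : skewSize μ smaller ≡ t
  size = begin
      skewSize μ smaller
    ≡⟨ skewSize≡∑< μ smaller ⟩
      ∑< (λ i → μr i ∸ νr i) (len μ)
    ≡⟨ ∑<-cong (len μ) (λ i _ → cong (μr i ∸_) (νr≡ν i)) ⟩
      ∑< δ (len μ)
    ≡⟨ cong (∑< δ) (sym (window j≤k (row-pos⇒<len μ k (μ-pos k ≤-refl)))) ⟩
      ∑< δ (j + (suc e + (len μ ∸ suc k)))
    ≡⟨ ∑<-window δ j (suc e) _ (λ i i<j → δ-same i (ν-<j i i<j)) (λ i → δ-same _ (ν->k _ (beyond-k i))) ⟩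
      ∑< (λ i → δ (j + i)) (suc e)
    ≡⟨ ∑δ≡t ⟩
      t
    ∎
    where
    open ≡-Reasoning
    δ-same : ∀ i → ν i ≡ μr i → δ i ≡ 0
    δ-same i eq = trans (cong (μr i ∸_) eq) (n∸n≡0 (μr i))
    beyond-k : ∀ i → k < j + (suc e + i)
    beyond-k i = subst (_< j + (suc e + i)) (sym k≡j+e) (+-monoʳ-< j (s≤s (m≤m+n e i)))

  strip : RemoveStrip t μ smaller
  strip = (λ i → subst (_≤ μr i) (sym (νr≡ν i)) (ν≤μ i)) , connected , no2x2 , size

module Abacus (t : ℕ) {{_ : NonZero t}} (μ : Partition) (m : ℕ) (len≤m : len μ ≤ m) where
  open BetaNumbers μ m len≤m public

  runner : ℕ → ℕ
  runner ρ = residueCount t μ m ρ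

  Stacked : Set
  Stacked = ∀ j → t ≤ β j → Σ ℕ λ j′ → j′ < m × β j′ ≡ β j ∸ t

  core⇒stacked : IsTCore t μ → Stacked
  core⇒stacked core j t≤βj with 1 ≤? bead (β j ∸ t)
  ... | yes occupied = bead⇒β _ occupied
  ... | no empty = ⊥-elim (core (LowerBead.smaller t μ m len≤m j t≤βj gap , LowerBead.strip t μ m len≤m j t≤βj gap))
    where
    gap : ∀ i → i < m → β i ≢ β j ∸ t
    gap i i<m eq = empty (β⇒bead i _ i<m eq)

  runner≡∑bead : ∀ ρ → ρ < t → runner ρ ≡ ∑< (λ k → bead (ρ + k * t)) (suc (β 0))
  runner≡∑bead ρ ρ<t =
    trans (∑<-cong m (λ q _ → residue-as-sum (β q) (s≤s (≤-trans (m/n≤m (β q) t) (β-antitone z≤n)))))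
          (∑<-swap (λ q k → indicator (β q ≟ ρ + k * t)) m (suc (β 0)))
    where
    residue-as-sum : ∀ x → x / t < suc (β 0) → indicator ((x % t) ≟ ρ) ≡ ∑< (λ k → indicator (x ≟ ρ + k * t)) (suc (β 0))
    residue-as-sum x lt with (x % t) ≟ ρ
    ... | yes eq = sym (trans (∑<-cong (suc (β 0)) (λ k _ → indicator-cong (x ≟ ρ + k * t) (k ≟ x / t) quotient (λ { refl → x≡ })))
                              (∑<-indicator-≡ (suc (β 0)) (x / t) lt))
      where
      x≡ : x ≡ ρ + (x / t) * t
      x≡ = trans (m≡m%n+[m/n]*n x t) (cong (_+ (x / t) * t) eq)
      quotient : ∀ {k} → x ≡ ρ + k * t → k ≡ x / t
      quotient {k} h = *-cancelʳ-≡ k (x / t) t (+-cancelˡ-≡ ρ _ _ (trans (sym h) x≡))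
    ... | no ne = sym (∑<-zero (suc (β 0)) (λ k _ → indicator-no (x ≟ ρ + k * t)
                    (λ h → ne (trans (cong (_% t) h) (trans ([m+kn]%n≡m%n ρ k t) (m<n⇒m%n≡m ρ<t))))))

  bead⇔<runner : Stacked → ∀ ρ → ρ < t → ∀ k → (1 ≤ bead (ρ + k * t) → k < runner ρ) × (k < runner ρ → 1 ≤ bead (ρ + k * t))
  bead⇔<runner stacked ρ ρ<t k = (λ h → subst (k <_) count≡ (proj₂ threshold h)) , (λ h → proj₁ threshold (subst (k <_) (sym count≡) h))
    where
    down : ∀ k → 1 ≤ bead (ρ + suc k * t) → 1 ≤ bead (ρ + k * t)
    down k h with bead⇒β _ h
    ... | q , q<m , βq with stacked q (subst (t ≤_) (sym βq) (≤-trans (m≤n+m t ρ) (+-monoʳ-≤ ρ (m≤m+n t (k * t)))))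
    ...   | q′ , q′<m , βq′ = β⇒bead q′ _ q′<m (trans βq′ (trans (cong (_∸ t) βq) lower))
      where
      lower : ρ + (t + k * t) ∸ t ≡ ρ + k * t
      lower = trans (cong (_∸ t) (solve 3 (λ r a b → r :+ (a :+ b) := a :+ (r :+ b)) refl ρ t (k * t))) (m+n∸m≡n t (ρ + k * t))
    bound : ∀ k → 1 ≤ bead (ρ + k * t) → k < suc (β 0)
    bound k h with bead⇒β _ h
    ... | q , q<m , βq = s≤s (≤-trans (m≤m*n k t) (≤-trans (m≤n+m (k * t) ρ) (subst (_≤ β 0) βq (β-antitone z≤n))))
    threshold = count-threshold (λ k → 1 ≤ bead (ρ + k * t)) (λ k → 1 ≤? bead (ρ + k * t)) down (suc (β 0)) bound k
    count≡ : ∑< (λ k → indicator (1 ≤? bead (ρ + k * t))) (suc (β 0)) ≡ runner ρ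
    count≡ = trans (∑<-cong (suc (β 0)) (λ k _ → indicator-1≤? (bead (ρ + k * t)) (bead≤1 (ρ + k * t))))
                   (sym (runner≡∑bead ρ ρ<t))

-- The Frobenius condition (α | α + 1), read off the cells of the diagram.
ShiftedSymmetric : Partition → Set
ShiftedSymmetric μ = ∀ i j → i ≤ j → (j < row μ i → i < row μ (suc j)) × (i < row μ (suc j) → j < row μ i)

module SymplecticCells (μ : Partition) where
  μr : ℕ → ℕ
  μr = row μ

  <conj⇔ : ∀ c q → (q < conj μ (suc c) → suc c ≤ μr q) × (suc c ≤ μr q → q < conj μ (suc c))
  <conj⇔ c q = subst (λ z → (q < z → suc c ≤ μr q) × (suc c ≤ μr q → q < z)) (sym (conj≡∑< μ (suc c)))
    (count-threshold (λ q → suc c ≤ μr q) (λ q → suc c ≤? μr q) (λ i h → ≤-trans h (row-suc-≤ μ i)) (len μ)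
       (λ i h → row-pos⇒<len μ i (≤-trans (s≤s z≤n) h)) q)

  OnDiagonal : ℕ → Set
  OnDiagonal p = suc p ≤ μr p

  rank : ℕ
  rank = ∑< (λ p → indicator (suc p ≤? μr p)) (len μ)

  <rank⇔ : ∀ p → (p < rank → OnDiagonal p) × (OnDiagonal p → p < rank)
  <rank⇔ = count-threshold OnDiagonal (λ p → suc p ≤? μr p) (λ i h → ≤-trans (≤-trans (n≤1+n _) h) (row-suc-≤ μ i))
             (len μ) (λ i h → row-pos⇒<len μ i (≤-trans (s≤s z≤n) h))

  rank-isRank : IsRank μ rank
  rank-isRank = attained rank refl , (λ { (suc p) _ h → proj₂ (<rank⇔ p) h })
    where
    attained : ∀ r → r ≡ rank → r ≡ 0 ⊎ r ≤ part μ r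
    attained zero    _  = inj₁ refl
    attained (suc p) eq = inj₂ (proj₁ (<rank⇔ p) (subst (p <_) eq (n<1+n p)))

  isRank⇒onDiagonal : ∀ r → IsRank μ r → ∀ p → p < r → OnDiagonal p
  isRank⇒onDiagonal r        (inj₁ refl , _) p ()
  isRank⇒onDiagonal (suc r′) (inj₂ h , _)    p (s≤s le) = ≤-trans (s≤s le) (≤-trans h (row-antitone μ le))

  <+1⇔≤ : ∀ {a b} → (a < b + 1 → a ≤ b) × (a ≤ b → a < b + 1)
  <+1⇔≤ {a} {b} = (λ h → m<1+n⇒m≤n (subst (a <_) (+-comm b 1) h)) , (λ h → subst (a <_) (+-comm 1 b) (s≤s h))

  symplectic⇒shiftedSymmetric : Symplectic μ → ShiftedSymmetric μ
  symplectic⇒shiftedSymmetric symp i j i≤j with suc i ≤? μr i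
  ... | yes diag = (λ h → proj₁ (<conj⇔ i (suc j)) (subst (suc j <_) (sym frobenius) (proj₂ <+1⇔≤ h)))
                 , (λ h → proj₁ <+1⇔≤ (subst (suc j <_) frobenius (proj₂ (<conj⇔ i (suc j)) h)))
    where
    frobenius : conj μ (suc i) ≡ μr i + 1
    frobenius = symp rank rank-isRank (suc i) (s≤s z≤n) (proj₂ (<rank⇔ i) diag)
  ... | no ¬diag = (λ h → ⊥-elim (<-irrefl refl (<-≤-trans h (≤-trans μi≤i i≤j))))
                 , (λ h → ⊥-elim (<-irrefl refl (<-≤-trans h (≤-trans (row-antitone μ (≤-trans i≤j (n≤1+n j))) μi≤i))))
    where
    μi≤i : μr i ≤ i
    μi≤i = ≤-pred (≰⇒> ¬diag)

  shiftedSymmetric⇒symplectic : ShiftedSymmetric μ → Symplectic μ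
  shiftedSymmetric⇒symplectic shifted r isRank (suc p) _ p<r = <-extensional column⇒row row⇒column
    where
    diag : OnDiagonal p
    diag = isRank⇒onDiagonal r isRank p p<r
    column⇒row′ : ∀ q → suc p ≤ μr q → q ≤ μr p
    column⇒row′ zero    _ = z≤n
    column⇒row′ (suc j) h with p ≤? j
    ... | yes p≤j = proj₂ (shifted p j p≤j) h
    ... | no p≰j  = ≤-trans (≰⇒> p≰j) (<⇒≤ diag)
    column⇒row : ∀ q → q < conj μ (suc p) → q < μr p + 1
    column⇒row q h = proj₂ <+1⇔≤ (column⇒row′ q (proj₁ (<conj⇔ p q) h))
    row⇒column′ : ∀ q → q ≤ μr p → suc p ≤ μr q
    row⇒column′ zero    _ = ≤-trans diag (row-antitone μ z≤n)
    row⇒column′ (suc j) h with p ≤? j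
    ... | yes p≤j = proj₁ (shifted p j p≤j) h
    ... | no p≰j  = ≤-trans diag (row-antitone μ (≰⇒> p≰j))
    row⇒column : ∀ q → q < μr p + 1 → q < conj μ (suc p)
    row⇒column q h = proj₂ (<conj⇔ p q) (row⇒column′ q (proj₁ <+1⇔≤ h))

-- In bead language μ is symplectic iff #≥ (m − 1 − d) = #≥ (m + d) + d + 1 for
-- every d < m, i.e. iff m − 1 is a bead and the positions m + d and
-- m − 2 − d carry exactly one bead between them.
module BeadSymmetry (μ : Partition) (m : ℕ) (len≤m : len μ ≤ m) (1≤m : 1 ≤ m) where
  open BetaNumbers μ m len≤m

  cell⇔#≥ : ∀ i j → (j < row μ i → i < #≥ (suc j + (m ∸ suc i))) × (i < #≥ (suc j + (m ∸ suc i)) → j < row μ i)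
  cell⇔#≥ i j with i <? m
  ... | yes i<m = (λ h → proj₂ (<#≥⇔ _ i i<m) (+-monoˡ-≤ (m ∸ suc i) h))
                , (λ h → +-cancelʳ-≤ (m ∸ suc i) (suc j) (row μ i) (proj₁ (<#≥⇔ _ i i<m) h))
  ... | no i≮m = (λ h → ⊥-elim (n≮0 (subst (j <_) (row-beyond-m i (≮⇒≥ i≮m)) h)))
               , (λ h → ⊥-elim (<-irrefl refl (<-≤-trans h (≤-trans (#≥≤m _) (≮⇒≥ i≮m)))))

  upper-cell⇔ : ∀ i d → (i + d < row μ i → i < #≥ (m + d)) × (i < #≥ (m + d) → i + d < row μ i)
  upper-cell⇔ i d with i <? m
  ... | yes i<m = (λ h → subst (λ z → i < #≥ z) position (proj₁ (cell⇔#≥ i (i + d)) h))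
                , (λ h → proj₂ (cell⇔#≥ i (i + d)) (subst (λ z → i < #≥ z) (sym position) h))
    where
    position : suc (i + d) + (m ∸ suc i) ≡ m + d
    position = trans (solve 3 (λ a b c → con 1 :+ (a :+ b) :+ c := b :+ (con 1 :+ a :+ c)) refl i d (m ∸ suc i))
                     (trans (cong (d +_) (m+[n∸m]≡n i<m)) (+-comm d m))
  ... | no i≮m = (λ h → ⊥-elim (n≮0 (subst (i + d <_) (row-beyond-m i (≮⇒≥ i≮m)) h)))
               , (λ h → ⊥-elim (<-irrefl refl (<-≤-trans h (≤-trans (#≥≤m _) (≮⇒≥ i≮m)))))

  lower-cell⇔ : ∀ i d → (i < row μ (suc (i + d)) → suc (i + d) < #≥ (m ∸ suc d))
                      × (suc (i + d) < #≥ (m ∸ suc d) → i < row μ (suc (i + d)))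
  lower-cell⇔ i d with suc (suc (i + d)) ≤? m
  ... | yes le = (λ h → subst (λ z → suc (i + d) < #≥ z) position (proj₁ (cell⇔#≥ (suc (i + d)) i) h))
               , (λ h → proj₂ (cell⇔#≥ (suc (i + d)) i) (subst (λ z → suc (i + d) < #≥ z) (sym position) h))
    where
    position : suc i + (m ∸ suc (suc (i + d))) ≡ m ∸ suc d
    position = +-cancelʳ-≡ (suc d) _ _ (begin
        suc i + (m ∸ suc (suc (i + d))) + suc d
      ≡⟨ solve 3 (λ a b x → (con 1 :+ a) :+ x :+ (con 1 :+ b) := x :+ (con 1 :+ (con 1 :+ (a :+ b))))
                 refl i d (m ∸ suc (suc (i + d))) ⟩
        (m ∸ suc (suc (i + d))) + suc (suc (i + d))
      ≡⟨ m∸n+n≡m le ⟩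
        m
      ≡⟨ sym (m∸n+n≡m (≤-trans (s≤s (m≤n+m d i)) (≤-trans (n≤1+n _) le))) ⟩
        (m ∸ suc d) + suc d
      ∎)
      where open ≡-Reasoning
  ... | no ¬le = (λ h → ⊥-elim (<-irrefl refl (<-≤-trans (proj₁ (cell⇔#≥ (suc (i + d)) i) h) beyond)))
               , (λ h → ⊥-elim (<-irrefl refl (<-≤-trans h beyond)))
    where
    beyond : ∀ {w} → #≥ w ≤ suc (i + d)
    beyond = ≤-trans (#≥≤m _) (≤-pred (≰⇒> ¬le))

  ShiftedSymmetricBeads : Set
  ShiftedSymmetricBeads = ∀ i d → (i < #≥ (m + d) → i + suc d < #≥ (m ∸ suc d)) × (i + suc d < #≥ (m ∸ suc d) → i < #≥ (m + d))

  shiftedSymmetric⇒beads : ShiftedSymmetric μ → ShiftedSymmetricBeads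
  shiftedSymmetric⇒beads shifted i d =
      (λ h → subst (_< #≥ (m ∸ suc d)) (sym (+-suc i d)) (proj₁ (lower-cell⇔ i d) (proj₁ cells (proj₂ (upper-cell⇔ i d) h))))
    , (λ h → proj₁ (upper-cell⇔ i d) (proj₂ cells (proj₂ (lower-cell⇔ i d) (subst (_< #≥ (m ∸ suc d)) (+-suc i d) h))))
    where
    cells = shifted i (i + d) (m≤m+n i d)

  beads⇒shiftedSymmetric : ShiftedSymmetricBeads → ShiftedSymmetric μ
  beads⇒shiftedSymmetric beads i j i≤j =
    subst (λ z → (z < row μ i → i < row μ (suc z)) × (i < row μ (suc z) → z < row μ i)) (m+[n∸m]≡n i≤j)
      ( (λ h → proj₂ (lower-cell⇔ i d) (subst (_< #≥ (m ∸ suc d)) (+-suc i d) (proj₁ (beads i d) (proj₁ (upper-cell⇔ i d) h))))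
      , (λ h → proj₂ (upper-cell⇔ i d) (proj₂ (beads i d) (subst (_< #≥ (m ∸ suc d)) (sym (+-suc i d)) (proj₁ (lower-cell⇔ i d) h)))))
    where
    d = j ∸ i

  PivotAt : ℕ → Set
  PivotAt d = #≥ (m ∸ suc d) ≡ #≥ (m + d) + suc d

  PivotIdentity : Set
  PivotIdentity = ∀ d → d < m → PivotAt d

  m∸1<m : m ∸ 1 < m
  m∸1<m = subst (m ∸ 1 <_) (m+[n∸m]≡n 1≤m) (n<1+n _)

  no-bead-above : PivotIdentity → ∀ d → m ∸ 1 ≤ d → #≥ (m + d) ≡ 0
  no-bead-above pivot d le = n≤0⇒n≡0 (≤-trans (#≥-antitone (+-monoʳ-≤ m le)) (≤-reflexive top≡0))
    where
    top≡0 : #≥ (m + (m ∸ 1)) ≡ 0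
    top≡0 = +-cancelʳ-≡ m _ 0 (begin
        #≥ (m + (m ∸ 1)) + m
      ≡⟨ cong (#≥ (m + (m ∸ 1)) +_) (sym (m+[n∸m]≡n 1≤m)) ⟩
        #≥ (m + (m ∸ 1)) + suc (m ∸ 1)
      ≡⟨ sym (pivot (m ∸ 1) m∸1<m) ⟩
        #≥ (m ∸ suc (m ∸ 1))
      ≡⟨ cong (λ z → #≥ (m ∸ z)) (m+[n∸m]≡n 1≤m) ⟩
        #≥ (m ∸ m)
      ≡⟨ cong #≥ (n∸n≡0 m) ⟩
        #≥ 0
      ≡⟨ #≥0≡m ⟩
        m
      ∎)
      where open ≡-Reasoning

  pivot⇒beads : PivotIdentity → ShiftedSymmetricBeads
  pivot⇒beads pivot i d with d <? m
  ... | yes d<m = (λ h → subst (i + suc d <_) (sym (pivot d d<m)) (+-monoˡ-< (suc d) h))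
                , (λ h → +-cancelʳ-< (suc d) i _ (subst (i + suc d <_) (pivot d d<m) h))
  ... | no d≮m = (λ h → ⊥-elim (n≮0 (subst (i <_) (no-bead-above pivot d (≤-trans (m∸n≤m m 1) (≮⇒≥ d≮m))) h)))
               , (λ h → ⊥-elim (<-irrefl refl (<-≤-trans h (≤-trans (#≥≤m _) (≤-trans (≮⇒≥ d≮m) (≤-trans (n≤1+n d) (m≤n+m (suc d) i)))))))

  beads⇒pivot-occupied : ShiftedSymmetricBeads → ∀ d → 1 ≤ #≥ (m + d) → PivotAt d
  beads⇒pivot-occupied beads d occupied = <-extensional to from
    where
    to : ∀ k → k < #≥ (m ∸ suc d) → k < #≥ (m + d) + suc d
    to k h with suc d ≤? k
    ... | no k<sd = ≤-trans (≰⇒> k<sd) (m≤n+m (suc d) _)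
    ... | yes le = subst (_< #≥ (m + d) + suc d) (m∸n+n≡m le)
                     (+-monoˡ-< (suc d) (proj₂ (beads (k ∸ suc d) d) (subst (_< #≥ (m ∸ suc d)) (sym (m∸n+n≡m le)) h)))
    from : ∀ k → k < #≥ (m + d) + suc d → k < #≥ (m ∸ suc d)
    from k h with suc d ≤? k
    ... | no k<sd = <-≤-trans (≰⇒> k<sd) (<⇒≤ (proj₁ (beads 0 d) occupied))
    ... | yes le = subst (_< #≥ (m ∸ suc d)) (m∸n+n≡m le)
                     (proj₁ (beads (k ∸ suc d) d) (+-cancelʳ-< (suc d) _ _ (subst (_< #≥ (m + d) + suc d) (sym (m∸n+n≡m le)) h)))

  -- Where #≥ (m + d) = 0, argue by downward induction on d: the identity at
  -- d + 1 and #≥-split leave room for at most one more bead.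
  beads⇒pivot-from : ShiftedSymmetricBeads → ∀ k d → suc d + k ≡ m → PivotAt d
  beads⇒pivot-from beads k d eq with 1 ≤? #≥ (m + d)
  ... | yes occupied = beads⇒pivot-occupied beads d occupied
  beads⇒pivot-from beads zero d eq | no empty =
    trans (trans (cong #≥ (trans (cong (m ∸_) (trans (sym (+-identityʳ (suc d))) eq)) (n∸n≡0 m)))
                 (trans #≥0≡m (trans (sym eq) (+-identityʳ (suc d)))))
          (cong (_+ suc d) (sym (n≤0⇒n≡0 (≤-pred (≰⇒> empty)))))
  beads⇒pivot-from beads (suc k) d eq | no empty = trans (≤-antisym upper lower) (cong (_+ suc d) (sym #≥≡0))
    where
    #≥≡0 : #≥ (m + d) ≡ 0
    #≥≡0 = n≤0⇒n≡0 (≤-pred (≰⇒> empty))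
    eq′ : suc (suc d) + k ≡ m
    eq′ = trans (sym (+-suc (suc d) k)) eq
    sd<m : suc d < m
    sd<m = subst (suc (suc d) ≤_) eq′ (m≤m+n (suc (suc d)) k)
    upper : #≥ (m ∸ suc d) ≤ suc d
    upper = ≮⇒≥ (λ h → n≮0 (subst (0 <_) #≥≡0 (proj₂ (beads 0 d) h)))
    split : #≥ (m ∸ suc (suc d)) ≡ #≥ (m ∸ suc d) + bead (m ∸ suc (suc d))
    split = trans (#≥-split _) (cong (λ w → #≥ w + bead (m ∸ suc (suc d))) (sym (∸-pred-suc m (suc d) sd<m)))
    next : #≥ (m ∸ suc (suc d)) ≡ suc (suc d)
    next = trans (beads⇒pivot-from beads k (suc d) eq′)
                 (cong (_+ suc (suc d)) (n≤0⇒n≡0 (≤-trans (#≥-antitone (+-monoʳ-≤ m (n≤1+n d))) (≤-reflexive #≥≡0))))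
    lower : suc d ≤ #≥ (m ∸ suc d)
    lower = +-cancelʳ-≤ 1 _ _ (≤-trans (≤-reflexive (+-comm (suc d) 1))
              (subst (_≤ #≥ (m ∸ suc d) + 1) (trans (sym split) next) (+-monoʳ-≤ (#≥ (m ∸ suc d)) (bead≤1 _))))

  beads⇒pivot : ShiftedSymmetricBeads → PivotIdentity
  beads⇒pivot beads d d<m = beads⇒pivot-from beads (m ∸ suc d) d (m+[n∸m]≡n d<m)

  BeadBelowM : Set
  BeadBelowM = bead (m ∸ 1) ≡ 1

  BeadReflection : Set
  BeadReflection = ∀ y y′ → y + y′ + 2 ≡ m + m → m ≤ y → bead y + bead y′ ≡ 1

  #≥-split-below : #≥ (m ∸ 1) ≡ #≥ m + bead (m ∸ 1)
  #≥-split-below = trans (#≥-split (m ∸ 1)) (cong (λ w → #≥ w + bead (m ∸ 1)) (m+[n∸m]≡n 1≤m))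

  pivot-step : ∀ d → suc d < m → PivotAt d →
    #≥ (m ∸ suc (suc d)) ≡ #≥ (m + suc d) + (bead (m + d) + bead (m ∸ suc (suc d))) + suc d
  pivot-step d lt pivot-d = begin
      #≥ (m ∸ suc (suc d))
    ≡⟨ trans (#≥-split _) (cong (λ w → #≥ w + b₂) (sym (∸-pred-suc m (suc d) lt))) ⟩
      #≥ (m ∸ suc d) + b₂
    ≡⟨ cong (_+ b₂) pivot-d ⟩
      #≥ (m + d) + suc d + b₂
    ≡⟨ cong (λ z → z + suc d + b₂) (trans (#≥-split (m + d)) (cong (λ w → #≥ w + b₁) (sym (+-suc m d)))) ⟩
      #≥ (m + suc d) + b₁ + suc d + b₂
    ≡⟨ solve 4 (λ x a b s → x :+ a :+ s :+ b := x :+ (a :+ b) :+ s) refl (#≥ (m + suc d)) b₁ b₂ (suc d) ⟩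
      #≥ (m + suc d) + (b₁ + b₂) + suc d
    ∎
    where
    open ≡-Reasoning
    b₁ = bead (m + d)
    b₂ = bead (m ∸ suc (suc d))

  pivot-step⇔ : ∀ d → suc d < m → PivotAt d → (PivotAt (suc d) → bead (m + d) + bead (m ∸ suc (suc d)) ≡ 1)
                                            × (bead (m + d) + bead (m ∸ suc (suc d)) ≡ 1 → PivotAt (suc d))
  pivot-step⇔ d lt pivot-d =
      (λ pivot-sd → +-cancelʳ-≡ (suc d) _ 1 (+-cancelˡ-≡ (#≥ (m + suc d)) _ _
        (trans (sym (+-assoc (#≥ (m + suc d)) _ (suc d))) (trans (sym (pivot-step d lt pivot-d)) pivot-sd))))
    , (λ h → trans (pivot-step d lt pivot-d)
        (trans (cong (λ z → #≥ (m + suc d) + z + suc d) h) (+-assoc (#≥ (m + suc d)) 1 (suc d))))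

  pivot⇒beadBelowM : PivotIdentity → BeadBelowM
  pivot⇒beadBelowM pivot = +-cancelˡ-≡ (#≥ m) _ _
    (trans (sym #≥-split-below) (trans (pivot 0 1≤m) (cong (λ w → #≥ w + 1) (+-identityʳ m))))

  pivot⇒reflection : PivotIdentity → BeadReflection
  pivot⇒reflection pivot y y′ eq m≤y =
    subst₂ (λ a b → bead a + bead b ≡ 1) (m+[n∸m]≡n m≤y) (sym y′≡)
      (proj₁ (pivot-step⇔ d sd<m (pivot d (<-trans (n<1+n d) sd<m))) (pivot (suc d) sd<m))
    where
    d = y ∸ m
    d+y′+2≡m : d + y′ + 2 ≡ m
    d+y′+2≡m = +-cancelˡ-≡ m _ _ (trans (solve 3 (λ a b c → a :+ (b :+ c :+ con 2) := a :+ b :+ c :+ con 2) refl m d y′)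
                 (trans (cong (λ z → z + y′ + 2) (m+[n∸m]≡n m≤y)) eq))
    sd<m : suc d < m
    sd<m = subst (suc (suc d) ≤_) (trans (solve 2 (λ a b → b :+ (con 2 :+ a) := a :+ b :+ con 2) refl d y′) d+y′+2≡m)
             (m≤n+m (2 + d) y′)
    y′≡ : y′ ≡ m ∸ suc (suc d)
    y′≡ = sym (trans (cong (_∸ suc (suc d)) (sym d+y′+2≡m))
            (trans (cong (_∸ (2 + d)) (solve 2 (λ a b → a :+ b :+ con 2 := b :+ (con 2 :+ a)) refl d y′)) (m+n∸n≡m y′ (2 + d))))

  reflection⇒pivot : BeadBelowM → BeadReflection → PivotIdentity
  reflection⇒pivot below reflection zero    _  =
    trans #≥-split-below (cong₂ _+_ (cong #≥ (sym (+-identityʳ m))) below)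
  reflection⇒pivot below reflection (suc d) lt =
    proj₂ (pivot-step⇔ d lt (reflection⇒pivot below reflection d (<-trans (n<1+n d) lt)))
      (reflection (m + d) (m ∸ suc (suc d)) positions (m≤m+n m d))
    where
    positions : m + d + (m ∸ suc (suc d)) + 2 ≡ m + m
    positions = trans (solve 3 (λ a b x → a :+ b :+ x :+ con 2 := a :+ (x :+ (con 2 :+ b))) refl m d (m ∸ suc (suc d)))
                      (cong (m +_) (m∸n+n≡m lt))

  pivot⇒β<m+m-1 : PivotIdentity → ∀ q → q < m → β q < m + (m ∸ 1)
  pivot⇒β<m+m-1 pivot q lt = ≰⇒> (λ h → n≮0 (subst (q <_) (no-bead-above pivot (m ∸ 1) ≤-refl) (proj₂ (<#≥⇔ _ q lt) h)))

  symplectic⇔pivot : (Symplectic μ → PivotIdentity) × (PivotIdentity → Symplectic μ)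
  symplectic⇔pivot = (λ symp → beads⇒pivot (shiftedSymmetric⇒beads (symplectic⇒shiftedSymmetric symp)))
                   , (λ pivot → shiftedSymmetric⇒symplectic (beads⇒shiftedSymmetric (pivot⇒beads pivot)))
    where open SymplecticCells μ

-- With t = t2 + 2 and m = t n, the reflection y ↦ 2m − 2 − y sends level k of
-- runner ρ ≤ t2 to level 2n − 1 − k of runner t2 − ρ, and level k of the last
-- runner t2 + 1 to level 2n − 2 − k of the same runner.
module RunnerCounts (t2 n : ℕ) (1≤n : 1 ≤ n) (μ : Partition) (len≤m : len μ ≤ suc (suc t2) * n)
                    (stacked : Abacus.Stacked (suc (suc t2)) μ (suc (suc t2) * n) len≤m) where
  t : ℕ
  t = suc (suc t2)

  m : ℕ
  m = t * n

  1≤m : 1 ≤ m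
  1≤m = ≤-trans 1≤n (m≤n*m n t)

  open Abacus t μ m len≤m
  open BeadSymmetry μ m len≤m 1≤m

  t2<t : t2 < t
  t2<t = ≤-trans (n≤1+n (suc t2)) ≤-refl

  bead≡0 : ∀ y → ¬ (1 ≤ bead y) → bead y ≡ 0
  bead≡0 y h = n≤0⇒n≡0 (≤-pred (≰⇒> h))

  bead-on : ∀ ρ k → ρ < t → k < runner ρ → bead (ρ + k * t) ≡ 1
  bead-on ρ k ρ<t h = ≤-antisym (bead≤1 _) (proj₂ (bead⇔<runner stacked ρ ρ<t k) h)

  bead-off : ∀ ρ k → ρ < t → ¬ (k < runner ρ) → bead (ρ + k * t) ≡ 0
  bead-off ρ k ρ<t h = bead≡0 _ (λ b → h (proj₁ (bead⇔<runner stacked ρ ρ<t k) b))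

  [ρ+kt]%t≡ρ : ∀ ρ k → ρ < t → (ρ + k * t) % t ≡ ρ
  [ρ+kt]%t≡ρ ρ k lt = trans ([m+kn]%n≡m%n ρ k t) (m<n⇒m%n≡m lt)

  m+m≡[n+n]*t : m + m ≡ (n + n) * t
  m+m≡[n+n]*t = solve 2 (λ T N → T :* N :+ T :* N := (N :+ N) :* T) refl t n

  n-1 : ℕ
  n-1 = n ∸ 1

  1+[n-1]≡n : suc n-1 ≡ n
  1+[n-1]≡n = m+[n∸m]≡n 1≤n

  m∸1≡last-top : m ∸ 1 ≡ suc t2 + n-1 * t
  m∸1≡last-top = trans (cong (λ z → t * z ∸ 1) (sym 1+[n-1]≡n))
    (cong (_∸ 1) (solve 2 (λ s k → (con 2 :+ s) :* (con 1 :+ k) := con 1 :+ ((con 1 :+ s) :+ k :* (con 2 :+ s))) refl t2 n-1))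

  reflected-level : ∀ ρ ρ′ k k′ → ρ + ρ′ ≡ t2 → suc k + k′ ≡ n + n → ρ + k * t + (ρ′ + k′ * t) + 2 ≡ m + m
  reflected-level ρ ρ′ k k′ ρ+ρ′≡t2 k+k′≡ = begin
      ρ + k * t + (ρ′ + k′ * t) + 2
    ≡⟨ cong (λ z → ρ + k * z + (ρ′ + k′ * z) + 2) (cong (λ z → suc (suc z)) (sym ρ+ρ′≡t2)) ⟩
      ρ + k * T + (ρ′ + k′ * T) + 2
    ≡⟨ solve 4 (λ r r′ k k′ → r :+ k :* (con 2 :+ (r :+ r′)) :+ (r′ :+ k′ :* (con 2 :+ (r :+ r′))) :+ con 2
                 := (con 2 :+ (r :+ r′)) :* ((con 1 :+ k) :+ k′)) refl ρ ρ′ k k′ ⟩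
      T * (suc k + k′)
    ≡⟨ cong₂ _*_ (cong (λ z → suc (suc z)) ρ+ρ′≡t2) k+k′≡ ⟩
      t * (n + n)
    ≡⟨ *-distribˡ-+ t n n ⟩
      m + m
    ∎
    where
    open ≡-Reasoning
    T = suc (suc (ρ + ρ′))

  reflected-level-last : ∀ k k′ → suc (suc k) + k′ ≡ n + n → suc t2 + k * t + (suc t2 + k′ * t) + 2 ≡ m + m
  reflected-level-last k k′ k+k′≡ = begin
      suc t2 + k * t + (suc t2 + k′ * t) + 2
    ≡⟨ solve 3 (λ s k k′ → (con 1 :+ s) :+ k :* (con 2 :+ s) :+ ((con 1 :+ s) :+ k′ :* (con 2 :+ s)) :+ con 2
                 := (con 2 :+ s) :* ((con 2 :+ k) :+ k′)) refl t2 k k′ ⟩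
      t * (suc (suc k) + k′)
    ≡⟨ cong (t *_) k+k′≡ ⟩
      t * (n + n)
    ≡⟨ *-distribˡ-+ t n n ⟩
      m + m
    ∎
    where open ≡-Reasoning

  reflection-unique : ∀ y y′ y″ → y + y′ + 2 ≡ m + m → y + y″ + 2 ≡ m + m → y′ ≡ y″
  reflection-unique y y′ y″ h h′ = +-cancelˡ-≡ y _ _ (+-cancelʳ-≡ 2 _ _ (trans h (sym h′)))

  complement-<⇔ : ∀ k k′ a b N → suc k + k′ ≡ N → a + b ≡ N → (k′ < b → a ≤ k) × (a ≤ k → k′ < b)
  complement-<⇔ k k′ a b N k+k′≡N a+b≡N =
      (λ h → +-cancelʳ-≤ (suc k′) a k (subst (a + suc k′ ≤_) (trans (sym k+k′≡N) (+-suc-comm k k′))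
               (≤-trans (+-monoʳ-≤ a h) (≤-reflexive a+b≡N))))
    , (λ h → +-cancelˡ-≤ a (suc k′) b (≤-trans (+-monoˡ-≤ (suc k′) h)
               (≤-reflexive (trans (sym (+-suc-comm k k′)) (trans k+k′≡N (sym a+b≡N))))))
    where
    +-suc-comm : ∀ x y → suc x + y ≡ x + suc y
    +-suc-comm x y = sym (+-suc x y)

  RunnerCondition : Set
  RunnerCondition = (∀ i → i ≤ t2 / 2 → runner i + runner (t2 ∸ i) ≡ 2 * n) × runner (suc t2) ≡ n

  2*n≡n+n : 2 * n ≡ n + n
  2*n≡n+n = cong (n +_) (+-identityʳ n)

  t2∸i≤t2/2 : ∀ i → i ≤ t2 → ¬ (i ≤ t2 / 2) → t2 ∸ i ≤ t2 / 2
  t2∸i≤t2/2 i i≤t2 i≰ = +-cancelʳ-≤ i _ _ (subst (_≤ t2 / 2 + i) (sym (m∸n+n≡m i≤t2)) (≤-trans t2≤ (+-monoʳ-≤ (t2 / 2) (≰⇒> i≰))))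
    where
    h = t2 / 2
    t2≤ : t2 ≤ h + suc h
    t2≤ = subst (_≤ h + suc h) (sym (m≡m%n+[m/n]*n t2 2))
            (≤-trans (+-monoˡ-≤ (h * 2) (≤-pred (m%n<n t2 2))) (≤-reflexive (solve 1 (λ h → con 1 :+ h :* con 2 := h :+ (con 1 :+ h)) refl h)))

  runner-pairs : RunnerCondition → ∀ i → i ≤ t2 → runner i + runner (t2 ∸ i) ≡ n + n
  runner-pairs (pairs , _) i i≤t2 with i ≤? t2 / 2
  ... | yes i≤ = trans (pairs i i≤) 2*n≡n+n
  ... | no i≰ = trans (+-comm (runner i) _)
                  (trans (cong (λ z → runner (t2 ∸ i) + runner z) (sym (m∸[m∸n]≡n i≤t2)))
                         (trans (pairs (t2 ∸ i) (t2∸i≤t2/2 i i≤t2 i≰)) 2*n≡n+n))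

  runnerCondition⇒beadBelowM : RunnerCondition → BeadBelowM
  runnerCondition⇒beadBelowM (_ , last) = subst (λ z → bead z ≡ 1) (sym m∸1≡last-top)
    (bead-on (suc t2) n-1 ≤-refl (subst (n-1 <_) (sym (trans last (sym 1+[n-1]≡n))) ≤-refl))

  reflection-paired : RunnerCondition → ∀ ρ k y′ → ρ ≤ t2 → ρ + k * t + y′ + 2 ≡ m + m →
    bead (ρ + k * t) + bead y′ ≡ 1
  reflection-paired cond ρ k y′ ρ≤t2 eq = subst (λ z → bead (ρ + k * t) + bead z ≡ 1) (sym y′≡) both
    where
    k<2n : k < n + n
    k<2n = *-cancelʳ-< t k (n + n) (subst (k * t <_) m+m≡[n+n]*t
             (≤-<-trans (m≤n+m (k * t) ρ) (subst (ρ + k * t <_) eq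
               (≤-<-trans (m≤m+n (ρ + k * t) y′) (m<m+n (ρ + k * t + y′) (s≤s z≤n))))))
    k′ = (n + n) ∸ suc k
    ρ′ = t2 ∸ ρ
    y′≡ : y′ ≡ ρ′ + k′ * t
    y′≡ = reflection-unique _ _ _ eq (reflected-level ρ ρ′ k k′ (m+[n∸m]≡n ρ≤t2) (m+[n∸m]≡n k<2n))
    ρ<t : ρ < t
    ρ<t = ≤-<-trans ρ≤t2 t2<t
    ρ′<t : ρ′ < t
    ρ′<t = ≤-<-trans (m∸n≤m t2 ρ) t2<t
    shift = complement-<⇔ k k′ (runner ρ) (runner ρ′) (n + n) (m+[n∸m]≡n k<2n) (runner-pairs cond ρ ρ≤t2)
    both : bead (ρ + k * t) + bead (ρ′ + k′ * t) ≡ 1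
    both with k <? runner ρ
    ... | yes h = cong₂ _+_ (bead-on ρ k ρ<t h) (bead-off ρ′ k′ ρ′<t (λ h′ → <-irrefl refl (<-≤-trans h (proj₁ shift h′))))
    ... | no h  = cong₂ _+_ (bead-off ρ k ρ<t h) (bead-on ρ′ k′ ρ′<t (proj₂ shift (≮⇒≥ h)))

  reflection-last : RunnerCondition → ∀ k y′ → m ≤ suc t2 + k * t → suc t2 + k * t + y′ + 2 ≡ m + m →
    bead (suc t2 + k * t) + bead y′ ≡ 1
  reflection-last cond k y′ m≤y eq = subst (λ z → bead (suc t2 + k * t) + bead z ≡ 1) (sym y′≡) both
    where
    n≤k : n ≤ k
    n≤k = ≮⇒≥ (λ k<n → <-irrefl refl (<-≤-trans (+-monoˡ-< (k * t) (n<1+n (suc t2)))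
            (≤-trans (*-monoˡ-≤ t k<n) (≤-trans (≤-reflexive (*-comm n t)) m≤y))))
    sk<2n : suc k < n + n
    sk<2n = *-cancelʳ-< t (suc k) (n + n) (subst (suc k * t <_) m+m≡[n+n]*t
              (subst (_≤ m + m) (sym (solve 2 (λ s x → con 3 :+ s :+ x := con 1 :+ s :+ x :+ con 2) refl t2 (k * t)))
                (subst (suc t2 + k * t + 2 ≤_) eq (+-monoˡ-≤ 2 (m≤m+n (suc t2 + k * t) y′)))))
    k′ = (n + n) ∸ suc (suc k)
    y′≡ : y′ ≡ suc t2 + k′ * t
    y′≡ = reflection-unique (suc t2 + k * t) y′ _ eq (reflected-level-last k k′ (m+[n∸m]≡n sk<2n))
    k′<n : k′ < n
    k′<n = +-cancelʳ-≤ n (suc k′) n (≤-trans (+-monoʳ-≤ (suc k′) n≤k)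
             (≤-trans (≤-trans (≤-reflexive (cong suc (+-comm k′ k))) (n≤1+n _)) (≤-reflexive (m+[n∸m]≡n sk<2n))))
    both : bead (suc t2 + k * t) + bead (suc t2 + k′ * t) ≡ 1
    both = cong₂ _+_ (bead-off (suc t2) k ≤-refl (λ h → <-irrefl refl (<-≤-trans h (subst (_≤ k) (sym (proj₂ cond)) n≤k))))
                     (bead-on (suc t2) k′ ≤-refl (subst (k′ <_) (sym (proj₂ cond)) k′<n))

  reflection-at : RunnerCondition → ∀ ρ k y′ → ρ < t → m ≤ ρ + k * t → ρ + k * t + y′ + 2 ≡ m + m →
    bead (ρ + k * t) + bead y′ ≡ 1
  reflection-at cond ρ k y′ ρ<t m≤y eq with ρ ≤? t2
  ... | yes ρ≤t2 = reflection-paired cond ρ k y′ ρ≤t2 eq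
  ... | no ρ≰t2 with ≤-antisym (≤-pred ρ<t) (≰⇒> ρ≰t2)
  ...   | refl = reflection-last cond k y′ m≤y eq

  runnerCondition⇒reflection : RunnerCondition → BeadReflection
  runnerCondition⇒reflection cond y y′ eq m≤y =
    subst (λ z → bead z + bead y′ ≡ 1) (sym y≡)
      (reflection-at cond (y % t) (y / t) y′ (m%n<n y t) (subst (m ≤_) y≡ m≤y) (subst (λ z → z + y′ + 2 ≡ m + m) y≡ eq))
    where
    y≡ : y ≡ y % t + (y / t) * t
    y≡ = m≡m%n+[m/n]*n y t

  module FromPivot (pivot : PivotIdentity) where
    empty-above : ∀ y → m + (m ∸ 1) ≤ y → bead y ≡ 0
    empty-above y le = bead≡0 y (λ h → no-β (bead⇒β y h))
      where
      no-β : (Σ ℕ λ q → q < m × β q ≡ y) → ⊥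
      no-β (q , q<m , βq) = <-irrefl refl (<-≤-trans (pivot⇒β<m+m-1 pivot q q<m) (subst (m + (m ∸ 1) ≤_) (sym βq) le))

    reflection-everywhere : ∀ y y′ → y + y′ + 2 ≡ m + m → y ≢ m ∸ 1 → bead y + bead y′ ≡ 1
    reflection-everywhere y y′ eq y≢m-1 with m ≤? y
    ... | yes m≤y = pivot⇒reflection pivot y y′ eq m≤y
    ... | no m≰y = trans (+-comm (bead y) (bead y′)) (pivot⇒reflection pivot y′ y (trans (cong (_+ 2) (+-comm y′ y)) eq) m≤y′)
      where
      y+2≤m : suc (suc y) ≤ m
      y+2≤m with m≤n⇒m<n∨m≡n (≰⇒> m≰y)
      ... | inj₁ lt = lt
      ... | inj₂ eq′ = ⊥-elim (y≢m-1 (cong (_∸ 1) eq′))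
      m≤y′ : m ≤ y′
      m≤y′ = +-cancelˡ-≤ m m y′ (subst (_≤ m + y′) eq (subst (_≤ m + y′) (solve 2 (λ a b → a :+ con 2 :+ b := a :+ b :+ con 2) refl y y′)
               (+-monoˡ-≤ y′ (subst (_≤ m) (+-comm 2 y) y+2≤m))))

    runner≤2n : ∀ ρ → ρ < t → runner ρ ≤ n + n
    runner≤2n ρ ρ<t = ≮⇒≥ (λ h → n≮0 (subst (0 <_) (empty-above _ beyond) (proj₂ (bead⇔<runner stacked ρ ρ<t (n + n)) h)))
      where
      beyond : m + (m ∸ 1) ≤ ρ + (n + n) * t
      beyond = ≤-trans (+-monoʳ-≤ m (m∸n≤m m 1)) (≤-trans (≤-reflexive m+m≡[n+n]*t) (m≤n+m _ ρ))

    paired-reflection : ∀ ρ → ρ ≤ t2 → ∀ k → k < n + n →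
      bead (ρ + k * t) + bead (t2 ∸ ρ + ((n + n) ∸ suc k) * t) ≡ 1
    paired-reflection ρ ρ≤t2 k k<2n =
      reflection-everywhere _ _ (reflected-level ρ (t2 ∸ ρ) k _ (m+[n∸m]≡n ρ≤t2) (m+[n∸m]≡n k<2n)) ≢m-1
      where
      ≢m-1 : ρ + k * t ≢ m ∸ 1
      ≢m-1 eq = <-irrefl refl (subst (_≤ t2) (trans (sym ([ρ+kt]%t≡ρ ρ k (≤-<-trans ρ≤t2 t2<t)))
                  (trans (cong (_% t) (trans eq m∸1≡last-top)) ([ρ+kt]%t≡ρ (suc t2) n-1 ≤-refl))) ρ≤t2)

    runner-pair-≥ : ∀ ρ → ρ ≤ t2 → n + n ≤ runner ρ + runner (t2 ∸ ρ)
    runner-pair-≥ ρ ρ≤t2 with runner ρ <? n + n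
    ... | no ≮2n = ≤-trans (≮⇒≥ ≮2n) (m≤m+n _ _)
    ... | yes <2n = ≤-trans (≤-reflexive (trans (sym (m+[n∸m]≡n <2n)) (sym (+-suc (runner ρ) k′)))) (+-monoʳ-≤ (runner ρ) k′<)
      where
      k′ = (n + n) ∸ suc (runner ρ)
      partner : bead (t2 ∸ ρ + k′ * t) ≡ 1
      partner = trans (sym (cong (_+ bead (t2 ∸ ρ + k′ * t)) (bead-off ρ (runner ρ) (≤-<-trans ρ≤t2 t2<t) (<-irrefl refl))))
                      (paired-reflection ρ ρ≤t2 (runner ρ) <2n)
      k′< : suc k′ ≤ runner (t2 ∸ ρ)
      k′< = proj₁ (bead⇔<runner stacked (t2 ∸ ρ) (≤-<-trans (m∸n≤m t2 ρ) t2<t) k′) (≤-reflexive (sym partner))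

    runner-pair-≤ : ∀ ρ → ρ ≤ t2 → runner ρ + runner (t2 ∸ ρ) ≤ n + n
    runner-pair-≤ ρ ρ≤t2 with runner ρ in eq
    ... | zero  = runner≤2n (t2 ∸ ρ) (≤-<-trans (m∸n≤m t2 ρ) t2<t)
    ... | suc a = ≤-trans (+-monoʳ-≤ (suc a) ≤k′) (≤-reflexive (m+[n∸m]≡n a<2n))
      where
      a<2n : a < n + n
      a<2n = ≤-trans (≤-reflexive (sym eq)) (runner≤2n ρ (≤-<-trans ρ≤t2 t2<t))
      k′ = (n + n) ∸ suc a
      partner : bead (t2 ∸ ρ + k′ * t) ≡ 0
      partner = +-cancelˡ-≡ 1 _ 0 (trans (sym (cong (_+ bead (t2 ∸ ρ + k′ * t))
                  (bead-on ρ a (≤-<-trans ρ≤t2 t2<t) (≤-reflexive (sym eq))))) (paired-reflection ρ ρ≤t2 a a<2n))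
      ≤k′ : runner (t2 ∸ ρ) ≤ k′
      ≤k′ = ≮⇒≥ (λ h → n≮0 (subst (0 <_) partner (proj₂ (bead⇔<runner stacked (t2 ∸ ρ) (≤-<-trans (m∸n≤m t2 ρ) t2<t) k′) h)))

    runner-last-≥ : n ≤ runner (suc t2)
    runner-last-≥ = subst (_≤ runner (suc t2)) 1+[n-1]≡n
      (proj₁ (bead⇔<runner stacked (suc t2) ≤-refl n-1) (≤-reflexive (sym (trans (cong bead (sym m∸1≡last-top)) (pivot⇒beadBelowM pivot)))))

    -- A bead at level n of the last runner lies beyond 2m − 2 when n = 1, and
    -- is reflected onto the bead at level n − 2 otherwise.
    runner-last-≤ : ∀ n′ → suc n′ ≡ n → ¬ (n < runner (suc t2))
    runner-last-≤ zero 1≡n h = n≮0 (subst (0 <_) (empty-above _ beyond) (≤-reflexive (sym (bead-on (suc t2) n ≤-refl h))))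
      where
      beyond : m + (m ∸ 1) ≤ suc t2 + n * t
      beyond = ≤-reflexive (subst (λ z → t * z + (t * z ∸ 1) ≡ suc t2 + z * t) 1≡n
                 (trans (cong (λ z → z + (z ∸ 1)) (*-identityʳ t)) (trans (+-comm t (suc t2)) (cong (suc t2 +_) (sym (+-identityʳ t))))))
    runner-last-≤ (suc n″) 2+n″≡n h =
      2≢1 (trans (sym (cong₂ _+_ (bead-on (suc t2) n ≤-refl h) (bead-on (suc t2) n″ ≤-refl n″<)))
                 (reflection-everywhere (suc t2 + n * t) (suc t2 + n″ * t) (reflected-level-last n n″ levels) ≢m-1))
      where
      2≢1 : 2 ≢ 1
      2≢1 ()
      n″< : n″ < runner (suc t2)
      n″< = <-trans (subst (suc n″ ≤_) 2+n″≡n (n≤1+n _)) h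
      levels : suc (suc n) + n″ ≡ n + n
      levels = subst (λ z → suc (suc z) + n″ ≡ z + z) 2+n″≡n (solve 1 (λ x → con 4 :+ x :+ x := (con 2 :+ x) :+ (con 2 :+ x)) refl n″)
      ≢m-1 : suc t2 + n * t ≢ m ∸ 1
      ≢m-1 eq = <-irrefl refl (<-≤-trans (subst (_< m) (sym eq) m∸1<m) (≤-trans (≤-reflexive (*-comm t n)) (m≤n+m _ _)))

    runnerCondition : RunnerCondition
    runnerCondition =
        (λ i i≤ → let i≤t2 = ≤-trans i≤ (m/n≤m t2 2) in trans (≤-antisym (runner-pair-≤ i i≤t2) (runner-pair-≥ i i≤t2)) (sym 2*n≡n+n))
      , ≤-antisym (≮⇒≥ (runner-last-≤ n-1 1+[n-1]≡n)) runner-last-≥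

  symplectic⇔runnerCondition : (Symplectic μ → RunnerCondition) × (RunnerCondition → Symplectic μ)
  symplectic⇔runnerCondition =
      (λ symp → FromPivot.runnerCondition (proj₁ symplectic⇔pivot symp))
    , (λ cond → proj₂ symplectic⇔pivot (reflection⇒pivot (runnerCondition⇒beadBelowM cond) (runnerCondition⇒reflection cond)))

corollary3p7 : (t n : ℕ) {{_ : NonZero t}} → 3 ≤ t → 1 ≤ n →
    (la : Partition) → len la ≤ t * n →
    (μ : Partition) → IsTCoreOf t la μ →
    (SymplecticTCore t μ ⇔
    ((∀ i → i ≤ (t ∸ 2) / 2 →
    nCount t la (t * n) i + nCount t la (t * n) (t ∸ 2 ∸ i) ≡ 2 * n)
    × nCount t la (t * n) (t ∸ 1) ≡ n))
corollary3p7 (suc (suc (suc t3))) n (s≤s (s≤s (s≤s _))) 1≤n la len≤m μ (strips , core) =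
  mk⇔ (λ { (symp , _) → to-nCount (proj₁ symplectic⇔runnerCondition symp) })
      (λ counts → proj₂ symplectic⇔runnerCondition (from-nCount counts) , core)
  where
  t = suc (suc (suc t3))
  m = t * n
  preserved = strips-preserve-residueCount t m strips len≤m
  open RunnerCounts (suc t3) n 1≤n μ (proj₁ preserved) (Abacus.core⇒stacked t μ m (proj₁ preserved) core)
    using (RunnerCondition; symplectic⇔runnerCondition)

  nCount≡coreCount : ∀ r → nCount t la m r ≡ residueCount t μ m r
  nCount≡coreCount r = trans (nCount≡residueCount t la m r) (sym (proj₂ preserved r))

  pair≡ : ∀ i → nCount t la m i + nCount t la m (suc t3 ∸ i) ≡ residueCount t μ m i + residueCount t μ m (suc t3 ∸ i)
  pair≡ i = cong₂ _+_ (nCount≡coreCount i) (nCount≡coreCount (suc t3 ∸ i))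

  to-nCount : RunnerCondition → (∀ i → i ≤ suc t3 / 2 → nCount t la m i + nCount t la m (suc t3 ∸ i) ≡ 2 * n)
                              × nCount t la m (suc (suc t3)) ≡ n
  to-nCount (pairs , last) = (λ i le → trans (pair≡ i) (pairs i le)) , trans (nCount≡coreCount _) last

  from-nCount : (∀ i → i ≤ suc t3 / 2 → nCount t la m i + nCount t la m (suc t3 ∸ i) ≡ 2 * n)
              × nCount t la m (suc (suc t3)) ≡ n → RunnerCondition
  from-nCount (pairs , last) = (λ i le → trans (sym (pair≡ i)) (pairs i le)) , trans (sym (nCount≡coreCount _)) last
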